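{- For every $X\in\{0,1\}^\omega$: $X$ is Martin-Löf $\mathrm{BP}$ random if and only if $X$ is martingale $\mathrm{BP}$ random.
   Context: Reals are elements $X\in\{0,1\}^\omega$. $X\upharpoonright n$ is the initial segment of length $n$. For a finite string $\sigma$, $[\sigma]=\{Y:\sigma\sqsubset Y\}$, and for a set $G$ of strings $[G]=\bigcup_{\sigma\in G}[\sigma]$. $\mu$ is the uniform measure on $\{0,1\}^\omega$. Strings and finite sets of strings are coded by natural numbers in a standard primitive recursive way. A primitive recursive test is a sequence of clopen sets $U_n=[G_n]$ such that: - there is a primitive recursive $g$ with $g(n)$ coding the finite set $G_n$; - $\mu(U_n)\le 2^{ -n}$ for all $n$. $X$ is Martin-Löf $\mathrm{BP}$ random if for every primitive recursive test there is $n$ with $X\notin U_n$. A martingale is a function $d:\{0,1\}^*\to\mathbb Q\cap[0,\infty)$ with $d(\emptyset)=1$ and $d(\sigma)=(d(\sigma0)+d(\sigma1))/2$ for all $\sigma$. A martingale $d$ succeeds primitive recursively on $X$ if there is a primitive recursive $f$ with $d(X\upharpoonright f(n))\ge 2^n$ for all $n$. $X$ is martingale $\mathrm{BP}$ random if no primitive recursive martingale succeeds primitive recursively on $X$. -}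

module Defs where

open import Data.Nat using (ℕ; zero; suc; _+_; _*_; _^_; _⊔_)
open import Data.Nat.DivMod using (_/_)
open import Data.Bool using (Bool; true; false; _∧_; _∨_; if_then_else_)
open import Data.List using (List; []; _∷_; [_]; _++_; length; filter; map; concatMap; foldr)
open import Data.Bool.ListAction using (any)
open import Data.Vec using (Vec; []; _∷_; lookup)
open import Data.Fin using (Fin)
open import Data.Integer using (+_)
open import Data.Rational as ℚ using (ℚ; ½)
open import Data.Product using (Σ; ∃; _×_; _,_)
open import Data.List.Membership.Propositional using (_∈_)
open import Relation.Binary.PropositionalEquality using (_≡_)
open import Relation.Nullary using (¬_)

data PR : ℕ → Set where
  Z    : ∀ {n} → PR n
  S    : PR 1
  P    : ∀ {n} → Fin n → PR n
  Comp : ∀ {m n} → PR m → Vec (PR n) m → PR n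
  Rec  : ∀ {n} → PR n → PR (suc (suc n)) → PR (suc n)

mutual
  eval : ∀ {n} → PR n → Vec ℕ n → ℕ
  eval Z xs = 0
  eval S (x ∷ []) = suc x
  eval (P i) xs = lookup xs i
  eval (Comp f gs) xs = eval f (evalVec gs xs)
  eval (Rec f g) (zero ∷ xs) = eval f xs
  eval (Rec f g) (suc k ∷ xs) = eval g (k ∷ eval (Rec f g) (k ∷ xs) ∷ xs)

  evalVec : ∀ {m n} → Vec (PR n) m → Vec ℕ n → Vec ℕ m
  evalVec [] xs = []
  evalVec (g ∷ gs) xs = eval g xs ∷ evalVec gs xs

IsPrimRec : (ℕ → ℕ) → Set
IsPrimRec f = Σ (PR 1) λ p → ∀ n → eval p (n ∷ []) ≡ f n

Real : Set
Real = ℕ → Bool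

Str : Set
Str = List Bool

_↾_ : Real → ℕ → Str
X ↾ zero = []
X ↾ suc n = X 0 ∷ ((λ k → X (suc k)) ↾ n)

_⊏_ : Str → Real → Set
σ ⊏ X = X ↾ length σ ≡ σ

_∈[_] : Real → List Str → Set
X ∈[ G ] = Σ Str λ σ → σ ∈ G × σ ⊏ X

bit : Bool → ℕ
bit false = 0
bit true  = 1

codeStr : Str → ℕ
codeStr [] = 0
codeStr (b ∷ σ) = suc (2 * codeStr σ + bit b)

-- Cantor pairing
pair : ℕ → ℕ → ℕ
pair a b = ((a + b) * suc (a + b)) / 2 + b

codeList : List ℕ → ℕ
codeList [] = 0
codeList (x ∷ xs) = suc (pair x (codeList xs))

codeSet : List Str → ℕ
codeSet G = codeList (map codeStr G)

eqb : Bool → Bool → Bool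
eqb true true = true
eqb false false = true
eqb _ _ = false

isPrefix : Str → Str → Bool
isPrefix [] τ = true
isPrefix (a ∷ σ) [] = false
isPrefix (a ∷ σ) (b ∷ τ) = eqb a b ∧ isPrefix σ τ

allStrings : ℕ → List Str
allStrings zero = [] ∷ []
allStrings (suc n) = concatMap (λ τ → (false ∷ τ) ∷ (true ∷ τ) ∷ []) (allStrings n)

maxLen : List Str → ℕ
maxLen = foldr (λ σ m → length σ ⊔ m) 0

countCovered : List Str → ℕ → ℕ
countCovered G L = length (filter (λ τ → Data.Bool.T? (any (λ σ → isPrefix σ τ) G)) (allStrings L))
  where import Data.Bool

μ : List Str → ℚ
μ G = ℚ._/_ (+ countCovered G (maxLen G)) (2 ^ maxLen G) {{Data.Nat.Properties.m^n≢0 2 (maxLen G)}}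
  where import Data.Nat.Properties

2^-_ : ℕ → ℚ
2^- n = ℚ._/_ (+ 1) (2 ^ n) {{Data.Nat.Properties.m^n≢0 2 n}}
  where import Data.Nat.Properties

record PRTest : Set where
  field
    G       : ℕ → List Str                                -- U n = [G n]
    primrec : IsPrimRec (λ n → codeSet (G n))
    small   : ∀ n → μ (G n) ℚ.≤ 2^- n

MLBPRandom : Real → Set
MLBPRandom X = (T : PRTest) → ¬ (∀ n → X ∈[ PRTest.G T n ])

record IsMartingale (d : Str → ℚ) : Set where
  field
    nonneg : ∀ σ → ℚ.0ℚ ℚ.≤ d σ
    root   : d [] ≡ ℚ.1ℚ
    fair   : ∀ σ → d σ ≡ ½ ℚ.* (d (σ ++ [ false ]) ℚ.+ d (σ ++ [ true ]))

IsPrimRecMartingale : (Str → ℚ) → Set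
IsPrimRecMartingale d =
  Σ (ℕ → ℕ) λ num → Σ (ℕ → ℕ) λ den →
    IsPrimRec (λ c → pair (num c) (den c)) ×
    (∀ σ → d σ ≡ ℚ._/_ (+ num (codeStr σ)) (suc (den (codeStr σ))))

SucceedsPR : (Str → ℚ) → Real → Set
SucceedsPR d X = Σ (ℕ → ℕ) λ f → IsPrimRec f ×
  (∀ n → ℚ._/_ (+ (2 ^ n)) 1 ℚ.≤ d (X ↾ f n))

MartingaleBPRandom : Real → Set
MartingaleBPRandom X =
  ¬ (Σ (Str → ℚ) λ d → IsMartingale d × IsPrimRecMartingale d × SucceedsPR d X)

module Submission where

-- Martingale to test: if d succeeds on X with witness f, let G n be the strings of
-- length f n on which d ≥ 2^n.  Kolmogorov's inequality bounds its measure by 2^-n,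
-- and G n is found by primitive recursively scanning all strings of length f n.
--
-- Test to martingale: put Vₙ = U₃ₙ₊₁ and let zₙ be the code of its generating set,
-- which bounds the lengths of its strings.  With mₙ(σ) the conditional measure of Vₙ
-- above σ (computed at length |σ| + zₙ) define
--   d = Σₙ dₙ,   dₙ(σ) = 2^-(n+1) + 2^n (mₙ(σ) − mₙ(σ↾n))  if n ≤ |σ|,  2^-(n+1) otherwise.
-- Each dₙ is a martingale, it is nonnegative because mₙ(σ↾n) ≤ 2^n μ(Vₙ) ≤ 2^-(2n+1),
-- and dₙ(X↾(n + zₙ)) ≥ 2^n when X ∈ Vₙ.  At length ℓ all values of d are multiples of
-- 2^-E(ℓ) with E(ℓ) = ℓ + 1 + Σ_{j ≤ ℓ} zⱼ, so its numerator is a primitive recursive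
-- natural-number expression and d is a primitive recursive martingale.

open import Defs
open import Function.Bundles using (_⇔_; mk⇔)

module Fraction where

  open import Data.Nat as ℕ using (ℕ; suc; NonZero)
  import Data.Nat.Properties as ℕP
  open import Data.Integer as ℤ using (+_)
  import Data.Integer.Properties as ℤP
  open import Data.Rational as ℚ using (ℚ; toℚᵘ)
  import Data.Rational.Properties as ℚP
  open import Data.Rational.Unnormalised as ℚᵘ using (mkℚᵘ; *≡*; *≤*)
  import Data.Rational.Unnormalised.Properties as ℚᵘP
  open import Relation.Binary.PropositionalEquality

  frac : ℕ → (b : ℕ) → .{{NonZero b}} → ℚ
  frac a b = (+ a) ℚ./ b

  toℚᵘ-frac : ∀ a b .{{_ : NonZero b}} → toℚᵘ (frac a b) ℚᵘ.≃ mkℚᵘ (+ a) (ℕ.pred b)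
  toℚᵘ-frac a (suc b) = ℚP.toℚᵘ-fromℚᵘ (mkℚᵘ (+ a) b)

  frac-≡ : ∀ a b c d .{{_ : NonZero b}} .{{_ : NonZero d}} → a ℕ.* d ≡ c ℕ.* b → frac a b ≡ frac c d
  frac-≡ a (suc b) c (suc d) e = ℚP.fromℚᵘ-cong cross
    where
    cross : mkℚᵘ (+ a) b ℚᵘ.≃ mkℚᵘ (+ c) d
    cross = *≡* (trans (sym (ℤP.pos-* a (suc d))) (trans (cong +_ e) (ℤP.pos-* c (suc b))))

  frac-≡⁻ : ∀ a b c d .{{_ : NonZero b}} .{{_ : NonZero d}} → frac a b ≡ frac c d → a ℕ.* d ≡ c ℕ.* b
  frac-≡⁻ a (suc b) c (suc d) e = ℚP.normalize-injective-≃ a c (suc b) (suc d) e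

  frac-≤ : ∀ a b c d .{{_ : NonZero b}} .{{_ : NonZero d}} → a ℕ.* d ℕ.≤ c ℕ.* b → frac a b ℚ.≤ frac c d
  frac-≤ a b@(suc _) c d@(suc _) le = ℚP.toℚᵘ-cancel-≤
    (ℚᵘP.≤-respʳ-≃ (ℚᵘP.≃-sym (toℚᵘ-frac c d)) (ℚᵘP.≤-respˡ-≃ (ℚᵘP.≃-sym (toℚᵘ-frac a b))
      (*≤* (subst₂ ℤ._≤_ (ℤP.pos-* a d) (ℤP.pos-* c b) (ℤ.+≤+ le)))))

  frac-≤⁻ : ∀ a b c d .{{_ : NonZero b}} .{{_ : NonZero d}} → frac a b ℚ.≤ frac c d → a ℕ.* d ℕ.≤ c ℕ.* b
  frac-≤⁻ a b@(suc _) c d@(suc _) le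
    with ℚᵘP.≤-respʳ-≃ (toℚᵘ-frac c d) (ℚᵘP.≤-respˡ-≃ (toℚᵘ-frac a b) (ℚP.toℚᵘ-mono-≤ le))
  ... | *≤* le′ = ℤP.drop‿+≤+ (subst₂ ℤ._≤_ (sym (ℤP.pos-* a d)) (sym (ℤP.pos-* c b)) le′)

  frac-+ : ∀ a b c d .{{_ : NonZero b}} .{{_ : NonZero d}} →
    frac a b ℚ.+ frac c d ≡ frac (a ℕ.* d ℕ.+ c ℕ.* b) (b ℕ.* d) {{ℕP.m*n≢0 b d}}
  frac-+ a b@(suc _) c d@(suc _) = ℚP.toℚᵘ-injective (ℚᵘP.≃-trans (ℚP.toℚᵘ-homo-+ (frac a b) (frac c d))
    (ℚᵘP.≃-trans (ℚᵘP.+-cong (toℚᵘ-frac a b) (toℚᵘ-frac c d))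
    (ℚᵘP.≃-sym (ℚᵘP.≃-trans (toℚᵘ-frac (a ℕ.* d ℕ.+ c ℕ.* b) (b ℕ.* d)) (*≡* (cong (ℤ._* (+ (b ℕ.* d))) num≡))))))
    where
    num≡ : + (a ℕ.* d ℕ.+ c ℕ.* b) ≡ (+ a) ℤ.* (+ d) ℤ.+ (+ c) ℤ.* (+ b)
    num≡ = trans (ℤP.pos-+ (a ℕ.* d) (c ℕ.* b)) (cong₂ ℤ._+_ (ℤP.pos-* a d) (ℤP.pos-* c b))

  frac-* : ∀ a b c d .{{_ : NonZero b}} .{{_ : NonZero d}} →
    frac a b ℚ.* frac c d ≡ frac (a ℕ.* c) (b ℕ.* d) {{ℕP.m*n≢0 b d}}
  frac-* a b@(suc _) c d@(suc _) = ℚP.toℚᵘ-injective (ℚᵘP.≃-trans (ℚP.toℚᵘ-homo-* (frac a b) (frac c d))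
    (ℚᵘP.≃-trans (ℚᵘP.*-cong (toℚᵘ-frac a b) (toℚᵘ-frac c d))
    (ℚᵘP.≃-sym (ℚᵘP.≃-trans (toℚᵘ-frac (a ℕ.* c) (b ℕ.* d)) (*≡* (cong (ℤ._* (+ (b ℕ.* d))) (ℤP.pos-* a c)))))))


module Arithmetic where

  open import Data.Nat using (ℕ; zero; suc; _+_; _*_; _∸_; _^_; _≤_; _<_; z≤n; s≤s)
  open import Data.Nat.Properties
  open import Data.Sum using (inj₁; inj₂)
  open import Relation.Binary.PropositionalEquality
  open import Data.Nat.Solver using (module +-*-Solver)
  open +-*-Solver

  sumTo : (ℕ → ℕ) → ℕ → ℕ
  sumTo f zero = 0
  sumTo f (suc k) = sumTo f k + f k

  sumTo-head : ∀ (f : ℕ → ℕ) N → sumTo f (suc N) ≡ f 0 + sumTo (λ r → f (suc r)) N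
  sumTo-head f zero = +-comm 0 (f 0)
  sumTo-head f (suc N) rewrite sumTo-head f N = +-assoc (f 0) _ _

  sumTo-cong : ∀ {f g : ℕ → ℕ} N → (∀ r → r < N → f r ≡ g r) → sumTo f N ≡ sumTo g N
  sumTo-cong zero h = refl
  sumTo-cong (suc N) h = cong₂ _+_ (sumTo-cong N (λ r lt → h r (≤-trans lt (n≤1+n N)))) (h N ≤-refl)

  sumTo-mono-≤ : ∀ {f g : ℕ → ℕ} N → (∀ r → r < N → f r ≤ g r) → sumTo f N ≤ sumTo g N
  sumTo-mono-≤ zero h = z≤n
  sumTo-mono-≤ (suc N) h = +-mono-≤ (sumTo-mono-≤ N (λ r lt → h r (≤-trans lt (n≤1+n N)))) (h N ≤-refl)

  sumTo-zero : ∀ (f : ℕ → ℕ) N → (∀ r → f r ≡ 0) → sumTo f N ≡ 0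
  sumTo-zero f zero h = refl
  sumTo-zero f (suc N) h rewrite sumTo-zero f N h = h N

  term≤sumTo : ∀ (f : ℕ → ℕ) N n → n < N → f n ≤ sumTo f N
  term≤sumTo f (suc N) n (s≤s le) with m≤n⇒m<n∨m≡n le
  ... | inj₁ lt = ≤-trans (term≤sumTo f N n lt) (m≤m+n _ _)
  ... | inj₂ refl = m≤n+m (f n) (sumTo f n)

  sumTo-+ : ∀ (f g : ℕ → ℕ) N → sumTo (λ n → f n + g n) N ≡ sumTo f N + sumTo g N
  sumTo-+ f g zero = refl
  sumTo-+ f g (suc N) rewrite sumTo-+ f g N =
    solve 4 (λ a b c d → (a :+ b) :+ (c :+ d) := (a :+ c) :+ (b :+ d)) refl (sumTo f N) (sumTo g N) (f N) (g N)

  sumTo-*ˡ : ∀ k (f : ℕ → ℕ) N → sumTo (λ n → k * f n) N ≡ k * sumTo f N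
  sumTo-*ˡ k f zero = sym (*-zeroʳ k)
  sumTo-*ˡ k f (suc N) rewrite sumTo-*ˡ k f N = sym (*-distribˡ-+ k (sumTo f N) (f N))

  [m∸n]+[o∸p]≡[m+o]∸[n+p] : ∀ m n o p → n ≤ m → p ≤ o → (m ∸ n) + (o ∸ p) ≡ (m + o) ∸ (n + p)
  [m∸n]+[o∸p]≡[m+o]∸[n+p] m n o p n≤m p≤o = begin
    (m ∸ n) + (o ∸ p) ≡⟨ sym (+-∸-assoc (m ∸ n) p≤o) ⟩
    (m ∸ n) + o ∸ p   ≡⟨ cong (_∸ p) (sym (+-∸-comm o n≤m)) ⟩
    m + o ∸ n ∸ p     ≡⟨ ∸-+-assoc (m + o) n p ⟩
    (m + o) ∸ (n + p) ∎
    where open ≡-Reasoning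

  [m+o]∸[n+o]≡m∸n : ∀ m n o → (m + o) ∸ (n + o) ≡ m ∸ n
  [m+o]∸[n+o]≡m∸n m n o = trans (cong₂ _∸_ (+-comm m o) (+-comm n o)) ([m+n]∸[m+o]≡n∸o o m n)

  n<2^n : ∀ n → n < 2 ^ n
  n<2^n zero = s≤s z≤n
  n<2^n (suc n) = subst (_< 2 ^ suc n) (+-comm n 1)
    (+-mono-<-≤ (n<2^n n) (subst (1 ≤_) (sym (+-identityʳ (2 ^ n))) (m^n>0 2 n)))

module PrimRec where

  open import Data.Nat as ℕ using (ℕ; zero; suc; _+_; _*_; _∸_; _^_)
  open import Data.Vec using (Vec; []; _∷_; lookup; tabulate)
  open import Data.Vec.Properties using (tabulate∘lookup)
  open import Data.Fin using (Fin) renaming (zero to f0; suc to fs)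
  open import Data.Product using (Σ; _,_; proj₁; proj₂)
  open import Relation.Binary.PropositionalEquality
  open import Data.Nat.Properties using (+-identityʳ; pred[m∸n]≡m∸[1+n]; m≤n⇒m∸n≡0)
  open Arithmetic using (sumTo)

  PRF : ℕ → Set
  PRF n = Vec ℕ n → ℕ

  IsPR : ∀ {n} → PRF n → Set
  IsPR {n} f = Σ (PR n) λ p → ∀ xs → eval p xs ≡ f xs

  record PRFun (n : ℕ) : Set where
    constructor mkF
    field
      fn : PRF n
      pr : IsPR fn
  open PRFun public

  isPR-ext : ∀ {n} {f g : PRF n} → (∀ xs → f xs ≡ g xs) → IsPR f → IsPR g
  isPR-ext e (p , h) = p , λ xs → trans (h xs) (e xs)

  constPR : ∀ {n} → ℕ → PR n
  constPR zero = Z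
  constPR (suc k) = Comp S (constPR k ∷ [])

  constPR-correct : ∀ {n} k (xs : Vec ℕ n) → eval (constPR k) xs ≡ k
  constPR-correct zero xs = refl
  constPR-correct (suc k) xs = cong suc (constPR-correct k xs)

  data Tm (n : ℕ) : Set where
    var : Fin n → Tm n
    lit : ℕ → Tm n
    op  : ∀ {m} → PRFun m → Vec (Tm n) m → Tm n

  mutual
    ⟦_⟧ : ∀ {n} → Tm n → PRF n
    ⟦ var i ⟧ xs = lookup xs i
    ⟦ lit k ⟧ xs = k
    ⟦ op f ts ⟧ xs = fn f (⟦ ts ⟧s xs)

    ⟦_⟧s : ∀ {n m} → Vec (Tm n) m → Vec ℕ n → Vec ℕ m
    ⟦ [] ⟧s xs = []
    ⟦ t ∷ ts ⟧s xs = ⟦ t ⟧ xs ∷ ⟦ ts ⟧s xs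

  mutual
    compile : ∀ {n} → Tm n → PR n
    compile (var i) = P i
    compile (lit k) = constPR k
    compile (op f ts) = Comp (proj₁ (pr f)) (compileVec ts)

    compileVec : ∀ {n m} → Vec (Tm n) m → Vec (PR n) m
    compileVec [] = []
    compileVec (t ∷ ts) = compile t ∷ compileVec ts

  mutual
    compile-correct : ∀ {n} (t : Tm n) xs → eval (compile t) xs ≡ ⟦ t ⟧ xs
    compile-correct (var i) xs = refl
    compile-correct (lit k) xs = constPR-correct k xs
    compile-correct (op f ts) xs rewrite compileVec-correct ts xs = proj₂ (pr f) (⟦ ts ⟧s xs)

    compileVec-correct : ∀ {n m} (ts : Vec (Tm n) m) xs → evalVec (compileVec ts) xs ≡ ⟦ ts ⟧s xs
    compileVec-correct [] xs = refl
    compileVec-correct (t ∷ ts) xs = cong₂ _∷_ (compile-correct t xs) (compileVec-correct ts xs)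

  term-isPR : ∀ {n} (t : Tm n) → IsPR ⟦ t ⟧
  term-isPR t = compile t , compile-correct t

  fromTerm : ∀ {n} (f : PRF n) (t : Tm n) → (∀ xs → ⟦ t ⟧ xs ≡ f xs) → PRFun n
  fromTerm f t e = mkF f (isPR-ext e (term-isPR t))

  primRec : ∀ {n} (h : PRF (suc n)) (f : PRFun n) (g : PRFun (suc (suc n))) →
    (∀ xs → h (0 ∷ xs) ≡ fn f xs) → (∀ k xs → h (suc k ∷ xs) ≡ fn g (k ∷ h (k ∷ xs) ∷ xs)) → PRFun (suc n)
  primRec {n} h f g e0 es = mkF h (Rec (proj₁ (pr f)) (proj₁ (pr g)) , ok)
    where
    ok : ∀ xs → eval (Rec (proj₁ (pr f)) (proj₁ (pr g))) xs ≡ h xs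
    ok (zero ∷ xs) = trans (proj₂ (pr f) xs) (sym (e0 xs))
    ok (suc k ∷ xs) rewrite ok (k ∷ xs) = trans (proj₂ (pr g) _) (sym (es k xs))

  uncurry₁ : (ℕ → ℕ) → PRF 1
  uncurry₁ f (x ∷ []) = f x
  uncurry₂ : (ℕ → ℕ → ℕ) → PRF 2
  uncurry₂ f (x ∷ y ∷ []) = f x y
  uncurry₃ : (ℕ → ℕ → ℕ → ℕ) → PRF 3
  uncurry₃ f (x ∷ y ∷ z ∷ []) = f x y z

  var₀ : ∀ {n} → Tm (suc n)
  var₀ = var f0
  var₁ : ∀ {n} → Tm (suc (suc n))
  var₁ = var (fs f0)
  var₂ : ∀ {n} → Tm (suc (suc (suc n)))
  var₂ = var (fs (fs f0))
  var₃ : ∀ {n} → Tm (suc (suc (suc (suc n))))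
  var₃ = var (fs (fs (fs f0)))

  succF : PRFun 1
  succF = mkF (uncurry₁ suc) (S , λ { (x ∷ []) → refl })

  _$1_ : ∀ {n} → PRFun 1 → Tm n → Tm n
  f $1 a = op f (a ∷ [])
  _$2_,_ : ∀ {n} → PRFun 2 → Tm n → Tm n → Tm n
  f $2 a , b = op f (a ∷ b ∷ [])
  app3 : ∀ {n} → PRFun 3 → Tm n → Tm n → Tm n → Tm n
  app3 f a b c = op f (a ∷ b ∷ c ∷ [])

  addF : PRFun 2
  addF = primRec (uncurry₂ _+_) (mkF (λ { (y ∷ []) → y }) (P f0 , λ { (y ∷ []) → refl }))
    (fromTerm (uncurry₃ λ k r y → suc r) (succF $1 var₁) λ { (k ∷ r ∷ y ∷ []) → refl })
    (λ { (y ∷ []) → refl }) (λ { k (y ∷ []) → refl })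

  mulF : PRFun 2
  mulF = primRec (uncurry₂ _*_) (fromTerm (λ _ → 0) (lit 0) λ { (y ∷ []) → refl })
    (fromTerm (uncurry₃ λ k r y → y + r) (addF $2 var₂ , var₁) λ { (k ∷ r ∷ y ∷ []) → refl })
    (λ { (y ∷ []) → refl }) (λ { k (y ∷ []) → refl })

  predF : PRFun 1
  predF = primRec (uncurry₁ ℕ.pred) (fromTerm (λ _ → 0) (lit 0) λ { [] → refl })
    (fromTerm (uncurry₂ λ k r → k) var₀ λ { (k ∷ r ∷ []) → refl })
    (λ { [] → refl }) (λ { k [] → refl })

  -- primRec recurses on the first argument, hence the reversed argument orders below.
  monusRevF : PRFun 2
  monusRevF = primRec (uncurry₂ λ y x → x ∸ y) (mkF (λ { (x ∷ []) → x }) (P f0 , λ { (x ∷ []) → refl }))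
    (fromTerm (uncurry₃ λ k r x → ℕ.pred r) (predF $1 var₁) λ { (k ∷ r ∷ x ∷ []) → refl })
    (λ { (x ∷ []) → refl }) (λ { k (x ∷ []) → sym (pred[m∸n]≡m∸[1+n] x k) })

  monusF : PRFun 2
  monusF = fromTerm (uncurry₂ _∸_) (monusRevF $2 var₁ , var₀) λ { (x ∷ y ∷ []) → refl }

  powF : PRFun 2
  powF = primRec (uncurry₂ λ y x → x ^ y) (fromTerm (λ _ → 1) (lit 1) λ { (x ∷ []) → refl })
    (fromTerm (uncurry₃ λ k r x → x * r) (mulF $2 var₂ , var₁) λ { (k ∷ r ∷ x ∷ []) → refl })
    (λ { (x ∷ []) → refl }) (λ { k (x ∷ []) → refl })

  pow2F : PRFun 1
  pow2F = fromTerm (uncurry₁ λ y → 2 ^ y) (powF $2 var₀ , lit 2) λ { (y ∷ []) → refl }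

  sg : ℕ → ℕ
  sg zero = 0
  sg (suc _) = 1

  nsg : ℕ → ℕ
  nsg zero = 1
  nsg (suc _) = 0

  sgF : PRFun 1
  sgF = primRec (uncurry₁ sg) (fromTerm (λ _ → 0) (lit 0) λ { [] → refl })
    (fromTerm (uncurry₂ λ k r → 1) (lit 1) λ { (k ∷ r ∷ []) → refl }) (λ { [] → refl }) (λ { k [] → refl })

  nsgF : PRFun 1
  nsgF = primRec (uncurry₁ nsg) (fromTerm (λ _ → 1) (lit 1) λ { [] → refl })
    (fromTerm (uncurry₂ λ k r → 0) (lit 0) λ { (k ∷ r ∷ []) → refl }) (λ { [] → refl }) (λ { k [] → refl })

  ite : ℕ → ℕ → ℕ → ℕ
  ite zero a b = b
  ite (suc _) a b = a

  iteF : PRFun 3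
  iteF = fromTerm (uncurry₃ ite) (addF $2 (mulF $2 (sgF $1 var₀) , var₁) , (mulF $2 (nsgF $1 var₀) , var₂))
    λ { (zero ∷ a ∷ b ∷ []) → +-identityʳ b ; (suc c ∷ a ∷ b ∷ []) → trans (+-identityʳ (a + 0)) (+-identityʳ a) }

  leq : ℕ → ℕ → ℕ
  leq x y = nsg (x ∸ y)

  leq-yes : ∀ {x y} → x ℕ.≤ y → leq x y ≡ 1
  leq-yes le rewrite m≤n⇒m∸n≡0 le = refl

  leq-no : ∀ {x y} → y ℕ.< x → leq x y ≡ 0
  leq-no {suc x} {zero} lt = refl
  leq-no {suc x} {suc y} (ℕ.s≤s lt) = leq-no {x} {y} lt

  leqF : PRFun 2
  leqF = fromTerm (uncurry₂ leq) (nsgF $1 (monusF $2 var₀ , var₁)) λ { (x ∷ y ∷ []) → refl }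

  eqn : ℕ → ℕ → ℕ
  eqn x y = leq x y * leq y x

  eqF : PRFun 2
  eqF = fromTerm (uncurry₂ eqn) (mulF $2 (leqF $2 var₀ , var₁) , (leqF $2 var₁ , var₀)) λ { (x ∷ y ∷ []) → refl }

  vars : ∀ {n m} → (Fin n → Fin m) → Vec (Tm m) n
  vars {zero} g = []
  vars {suc n} g = var (g f0) ∷ vars (λ i → g (fs i))

  vars-correct : ∀ {n m} (g : Fin n → Fin m) (ys : Vec ℕ m) → ⟦ vars g ⟧s ys ≡ tabulate (λ i → lookup ys (g i))
  vars-correct {zero} g ys = refl
  vars-correct {suc n} g ys = cong (lookup ys (g f0) ∷_) (vars-correct (λ i → g (fs i)) ys)

  vars-drop₂ : ∀ {n} (k r : ℕ) (xs : Vec ℕ n) → ⟦ vars (λ i → fs (fs i)) ⟧s (k ∷ r ∷ xs) ≡ xs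
  vars-drop₂ k r xs = trans (vars-correct (λ i → fs (fs i)) (k ∷ r ∷ xs)) (tabulate∘lookup xs)

  sumF : ∀ {n} → PRFun (suc n) → PRFun (suc n)
  sumF {n} f = primRec (λ { (k ∷ xs) → sumTo (λ i → fn f (i ∷ xs)) k })
    (fromTerm (λ _ → 0) (lit 0) λ _ → refl)
    (fromTerm (λ { (k ∷ r ∷ xs) → r + fn f (k ∷ xs) }) (addF $2 var₁ , op f (var₀ ∷ vars (λ i → fs (fs i))))
       λ { (k ∷ r ∷ xs) → cong (λ v → r + fn f (k ∷ v)) (vars-drop₂ k r xs) })
    (λ xs → refl) (λ k xs → refl)

  iter : (ℕ → ℕ) → ℕ → ℕ → ℕ
  iter g zero x = x
  iter g (suc j) x = g (iter g j x)

  iterF : PRFun 1 → PRFun 2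
  iterF g = primRec (uncurry₂ (iter (λ x → fn g (x ∷ [])))) (mkF (λ { (x ∷ []) → x }) (P f0 , λ { (x ∷ []) → refl }))
    (fromTerm (uncurry₃ λ k r x → fn g (r ∷ [])) (g $1 var₁) λ { (k ∷ r ∷ x ∷ []) → refl })
    (λ { (x ∷ []) → refl }) (λ { k (x ∷ []) → refl })


  toIsPrimRec : (F : PRFun 1) → IsPrimRec (λ n → fn F (n ∷ []))
  toIsPrimRec F = proj₁ (pr F) , λ n → proj₂ (pr F) (n ∷ [])

  fromIsPrimRec : ∀ {f} → IsPrimRec f → PRFun 1
  fromIsPrimRec {f} (p , h) = mkF (uncurry₁ f) (p , λ { (n ∷ []) → h n })

module Pairing where

  open PrimRec
  open import Data.Nat as ℕ using (ℕ; zero; suc; _+_; _*_; _∸_; _≤_; _<_; z≤n; s≤s)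
  open import Data.Nat.Properties
  open import Data.Nat.DivMod using (_/_; m*n/n≡m)
  open import Data.Vec using ([]; _∷_)
  open import Data.Empty using (⊥-elim)
  open import Data.Product using (_×_; _,_)
  open import Relation.Nullary using (yes; no)
  open import Relation.Binary.Definitions using (tri<; tri≈; tri>)
  open import Relation.Binary.PropositionalEquality
  open import Data.Nat.Solver using (module +-*-Solver)
  open +-*-Solver

  triangle : ℕ → ℕ
  triangle zero = 0
  triangle (suc s) = triangle s + suc s

  triangle*2 : ∀ s → triangle s * 2 ≡ s * suc s
  triangle*2 zero = refl
  triangle*2 (suc s) = begin
    (triangle s + suc s) * 2 ≡⟨ *-distribʳ-+ 2 (triangle s) (suc s) ⟩
    triangle s * 2 + suc s * 2 ≡⟨ cong (_+ suc s * 2) (triangle*2 s) ⟩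
    s * suc s + suc s * 2 ≡⟨ solve 1 (λ s → s :* (con 1 :+ s) :+ (con 1 :+ s) :* con 2 := (con 1 :+ s) :* (con 1 :+ (con 1 :+ s))) refl s ⟩
    suc s * suc (suc s) ∎
    where open ≡-Reasoning

  pair≡triangle : ∀ a b → pair a b ≡ triangle (a + b) + b
  pair≡triangle a b = cong (_+ b) (trans (cong (_/ 2) (sym (triangle*2 (a + b)))) (m*n/n≡m (triangle (a + b)) 2))

  triangle-mono-≤ : ∀ {s t} → s ≤ t → triangle s ≤ triangle t
  triangle-mono-≤ {zero} {t} _ = z≤n
  triangle-mono-≤ {suc s} {suc t} (s≤s le) = +-mono-≤ (triangle-mono-≤ le) (s≤s le)

  diagonal : ℕ → ℕ
  diagonal zero = 0
  diagonal (suc z) = diagonal z + leq (triangle (suc (diagonal z))) (suc z)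

  diagonal-bounds : ∀ z → triangle (diagonal z) ≤ z × z < triangle (suc (diagonal z))
  diagonal-bounds zero = z≤n , s≤s z≤n
  diagonal-bounds (suc z) with diagonal-bounds z | triangle (suc (diagonal z)) ≤? suc z
  ... | lo , hi | yes le rewrite leq-yes le | +-comm (diagonal z) 1 = le ,
    (begin-strict suc z ≤⟨ hi ⟩ triangle (suc (diagonal z)) <⟨ m<m+n (triangle (suc (diagonal z))) (s≤s z≤n) ⟩ triangle (suc (diagonal z)) + suc (suc (diagonal z)) ∎)
    where open ≤-Reasoning
  ... | lo , hi | no nle rewrite leq-no (≰⇒> nle) | +-identityʳ (diagonal z) = ≤-trans lo (n≤1+n z) , ≰⇒> nle

  diagonal-unique : ∀ {s z} → triangle s ≤ z → z < triangle (suc s) → diagonal z ≡ s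
  diagonal-unique {s} {z} lo hi with diagonal-bounds z | <-cmp (diagonal z) s
  ... | _ | tri≈ _ e _ = e
  ... | _ , hi' | tri< lt _ _ = ⊥-elim (<-irrefl refl (<-≤-trans hi' (≤-trans (triangle-mono-≤ lt) lo)))
  ... | lo' , _ | tri> _ _ gt = ⊥-elim (<-irrefl refl (<-≤-trans hi (≤-trans (triangle-mono-≤ gt) lo')))

  π₂ : ℕ → ℕ
  π₂ z = z ∸ triangle (diagonal z)

  π₁ : ℕ → ℕ
  π₁ z = diagonal z ∸ π₂ z

  diagonal-pair : ∀ a b → diagonal (pair a b) ≡ a + b
  diagonal-pair a b rewrite pair≡triangle a b = diagonal-unique (m≤m+n (triangle (a + b)) b)
    (+-monoʳ-< (triangle (a + b)) (s≤s (m≤n+m b a)))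

  π₂-pair : ∀ a b → π₂ (pair a b) ≡ b
  π₂-pair a b rewrite diagonal-pair a b | pair≡triangle a b = m+n∸m≡n (triangle (a + b)) b

  π₁-pair : ∀ a b → π₁ (pair a b) ≡ a
  π₁-pair a b = trans (cong₂ _∸_ (diagonal-pair a b) (π₂-pair a b)) (m+n∸n≡m a b)

  pair-≥₂ : ∀ a b → b ≤ pair a b
  pair-≥₂ a b rewrite pair≡triangle a b = m≤n+m b (triangle (a + b))

  n≤triangle : ∀ s → s ≤ triangle s
  n≤triangle zero = z≤n
  n≤triangle (suc s) = m≤n+m (suc s) (triangle s)

  pair-≥₁ : ∀ a b → a ≤ pair a b
  pair-≥₁ a b rewrite pair≡triangle a b = ≤-trans (≤-trans (m≤m+n a b) (n≤triangle (a + b))) (m≤m+n (triangle (a + b)) b)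

  triangleF : PRFun 1
  triangleF = primRec (uncurry₁ triangle) (fromTerm (λ _ → 0) (lit 0) λ { [] → refl })
    (fromTerm (uncurry₂ λ k r → r + suc k) (addF $2 var₁ , (succF $1 var₀)) λ { (k ∷ r ∷ []) → refl })
    (λ { [] → refl }) (λ { k [] → refl })

  diagonalF : PRFun 1
  diagonalF = primRec (uncurry₁ diagonal) (fromTerm (λ _ → 0) (lit 0) λ { [] → refl })
    (fromTerm (uncurry₂ λ k r → r + leq (triangle (suc r)) (suc k))
       (addF $2 var₁ , (leqF $2 (triangleF $1 (succF $1 var₁)) , (succF $1 var₀))) λ { (k ∷ r ∷ []) → refl })
    (λ { [] → refl }) (λ { k [] → refl })

  π₂F : PRFun 1
  π₂F = fromTerm (uncurry₁ π₂) (monusF $2 var₀ , (triangleF $1 (diagonalF $1 var₀))) λ { (z ∷ []) → refl }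

  π₁F : PRFun 1
  π₁F = fromTerm (uncurry₁ π₁) (monusF $2 (diagonalF $1 var₀) , (π₂F $1 var₀)) λ { (z ∷ []) → refl }

  pairF : PRFun 2
  pairF = fromTerm (uncurry₂ pair)
    (addF $2 (triangleF $1 (addF $2 var₀ , var₁)) , var₁)
    λ { (a ∷ b ∷ []) → sym (pair≡triangle a b) }


module Strings where

  open import Data.Nat using (zero; suc; _+_; _≤_; s≤s; _⊔_)
  open import Data.Nat.Properties using (suc-injective; ≤-trans; m≤m⊔n; m≤n⊔m)
  open import Data.Bool using (Bool; true; false; _∧_; _∨_)
  open import Data.Bool.Properties using (∨-zeroʳ)
  open import Data.Bool.ListAction using (any)
  open import Data.List using (List; []; _∷_; _++_; [_]; length; concatMap; take; drop)
  open import Data.List.Properties using (++-identityʳ; length-++-comm)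
  open import Data.List.Membership.Propositional using (_∈_)
  open import Data.List.Relation.Unary.Any using (here; there)
  open import Data.Product using (_×_; _,_; Σ)
  open import Relation.Binary.PropositionalEquality hiding ([_])

  length-↾ : ∀ X L → length (X ↾ L) ≡ L
  length-↾ X zero = refl
  length-↾ X (suc L) = cong suc (length-↾ (λ k → X (suc k)) L)

  eqb-refl : ∀ a → eqb a a ≡ true
  eqb-refl false = refl
  eqb-refl true = refl

  eqb-true : ∀ {a b} → eqb a b ≡ true → a ≡ b
  eqb-true {false} {false} _ = refl
  eqb-true {true} {true} _ = refl

  ∧-true : ∀ {a b} → a ∧ b ≡ true → a ≡ true × b ≡ true
  ∧-true {true} {true} _ = refl , refl

  isPrefix-++ : ∀ σ ρ → isPrefix σ (σ ++ ρ) ≡ true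
  isPrefix-++ [] ρ = refl
  isPrefix-++ (a ∷ σ) ρ rewrite eqb-refl a = isPrefix-++ σ ρ

  isPrefix-refl : ∀ τ → isPrefix τ τ ≡ true
  isPrefix-refl τ = subst (λ t → isPrefix τ t ≡ true) (++-identityʳ τ) (isPrefix-++ τ [])

  isPrefix-split : ∀ σ τ → isPrefix σ τ ≡ true → τ ≡ σ ++ drop (length σ) τ
  isPrefix-split [] τ _ = refl
  isPrefix-split (a ∷ σ) (b ∷ τ) e with ∧-true {eqb a b} e
  ... | e₁ , e₂ rewrite eqb-true e₁ = cong (b ∷_) (isPrefix-split σ τ e₂)

  isPrefix-sameLength : ∀ σ τ → length σ ≡ length τ → isPrefix σ τ ≡ true → σ ≡ τ
  isPrefix-sameLength σ τ e p = sym (trans (isPrefix-split σ τ p) (trans (cong (σ ++_) (drop-all σ τ e)) (++-identityʳ σ)))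
    where
    drop-all : ∀ (σ τ : Str) → length σ ≡ length τ → drop (length σ) τ ≡ []
    drop-all [] [] _ = refl
    drop-all (a ∷ σ) (b ∷ τ) e = drop-all σ τ (suc-injective e)

  isPrefix-++ʳ : ∀ σ τ ρ → length σ ≤ length τ → isPrefix σ (τ ++ ρ) ≡ isPrefix σ τ
  isPrefix-++ʳ [] τ ρ _ = refl
  isPrefix-++ʳ (a ∷ σ) (b ∷ τ) ρ (s≤s le) = cong (eqb a b ∧_) (isPrefix-++ʳ σ τ ρ le)

  ↾-isPrefix : ∀ X m L → m ≤ L → isPrefix (X ↾ m) (X ↾ L) ≡ true
  ↾-isPrefix X zero L _ = refl
  ↾-isPrefix X (suc m) (suc L) (s≤s le) rewrite eqb-refl (X 0) = ↾-isPrefix (λ k → X (suc k)) m L le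

  take-length-++ : ∀ (σ ρ : Str) → take (length σ) (σ ++ ρ) ≡ σ
  take-length-++ [] ρ = refl
  take-length-++ (a ∷ σ) ρ = cong (a ∷_) (take-length-++ σ ρ)

  take-++ʳ : ∀ n (σ ρ : Str) → n ≤ length σ → take n (σ ++ ρ) ≡ take n σ
  take-++ʳ zero σ ρ _ = refl
  take-++ʳ (suc n) (a ∷ σ) ρ (s≤s le) = cong (a ∷_) (take-++ʳ n σ ρ le)

  length-take-≤ : ∀ n (σ : Str) → n ≤ length σ → length (take n σ) ≡ n
  length-take-≤ zero σ _ = refl
  length-take-≤ (suc n) (a ∷ σ) (s≤s le) = cong suc (length-take-≤ n σ le)

  ∈⇒length≤maxLen : ∀ {σ} l → σ ∈ l → length σ ≤ maxLen l
  ∈⇒length≤maxLen {σ} (σ ∷ l) (here refl) = m≤m⊔n (length σ) (maxLen l)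
  ∈⇒length≤maxLen (τ ∷ l) (there m) = ≤-trans (∈⇒length≤maxLen l m) (m≤n⊔m (length τ) (maxLen l))

  any-cong : ∀ {p q : Str → Bool} l → (∀ {σ} → σ ∈ l → p σ ≡ q σ) → any p l ≡ any q l
  any-cong [] h = refl
  any-cong (σ ∷ l) h = cong₂ _∨_ (h (here refl)) (any-cong l (λ m → h (there m)))

  any-intro : ∀ (p : Str → Bool) {l σ} → σ ∈ l → p σ ≡ true → any p l ≡ true
  any-intro p (here refl) e rewrite e = refl
  any-intro p {x ∷ l} (there m) e rewrite any-intro p m e = ∨-zeroʳ (p x)

  any-elim : ∀ (p : Str → Bool) l → any p l ≡ true → Σ Str λ σ → σ ∈ l × p σ ≡ true
  any-elim p (x ∷ l) h with p x in e
  ... | true = x , here refl , e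
  ... | false with any-elim p l h
  ...   | σ , m , pσ = σ , there m , pσ

  prependBit : Str → List Str
  prependBit τ = (false ∷ τ) ∷ (true ∷ τ) ∷ []

  ∈-prependBit⁺ : ∀ {τ xs} b → τ ∈ xs → (b ∷ τ) ∈ concatMap prependBit xs
  ∈-prependBit⁺ false (here refl) = here refl
  ∈-prependBit⁺ true (here refl) = there (here refl)
  ∈-prependBit⁺ b (there p) = there (there (∈-prependBit⁺ b p))

  ∈-prependBit⁻ : ∀ {σ} xs → σ ∈ concatMap prependBit xs → Σ Bool λ b → Σ Str λ τ → σ ≡ b ∷ τ × τ ∈ xs
  ∈-prependBit⁻ (τ ∷ xs) (here refl) = false , τ , refl , here refl
  ∈-prependBit⁻ (τ ∷ xs) (there (here refl)) = true , τ , refl , here refl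
  ∈-prependBit⁻ (τ ∷ xs) (there (there p)) with ∈-prependBit⁻ xs p
  ... | b , τ′ , e , m = b , τ′ , e , there m

  ∈-allStrings⁺ : ∀ L σ → length σ ≡ L → σ ∈ allStrings L
  ∈-allStrings⁺ zero [] refl = here refl
  ∈-allStrings⁺ (suc L) (b ∷ σ) e = ∈-prependBit⁺ b (∈-allStrings⁺ L σ (suc-injective e))

  ∈-allStrings⁻ : ∀ L σ → σ ∈ allStrings L → length σ ≡ L
  ∈-allStrings⁻ zero .[] (here refl) = refl
  ∈-allStrings⁻ (suc L) σ m with ∈-prependBit⁻ (allStrings L) m
  ... | b , τ , refl , m′ = cong suc (∈-allStrings⁻ L τ m′)

  length-snoc : ∀ (σ : Str) b → length (σ ++ [ b ]) ≡ suc (length σ)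
  length-snoc σ b = length-++-comm σ [ b ]

module StringCode where

  open PrimRec
  open Strings
  open Arithmetic using (n<2^n)
  open Pairing using (pair-≥₁; pair-≥₂)
  open import Data.Nat as ℕ using (ℕ; zero; suc; _+_; _*_; _∸_; _^_; _≤_; _<_; z≤n; s≤s; NonZero)
  open import Data.Nat.Properties
  open import Data.Nat.DivMod using (_%_; m<n⇒m%n≡m; [m+kn]%n≡m%n; m%n<n; m≡m%n+[m/n]*n; _/_; n%n≡0)
  open import Data.Bool using (true; false)
  open import Data.List using ([]; _∷_; _++_; length; take; drop)
  open import Data.List.Properties using (length-++; take++drop≡id; length-take)
  open import Data.Vec using ([]; _∷_)
  open import Data.Product using (_×_; _,_; proj₁; proj₂)
  open import Data.Empty using (⊥-elim)
  open import Relation.Nullary using (yes; no)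
  open import Relation.Binary.Definitions using (tri<; tri≈; tri>)
  open import Relation.Binary.PropositionalEquality hiding ([_])
  open import Data.Nat.Solver using (module +-*-Solver)
  open +-*-Solver

  codeStr-++ : ∀ σ ρ → codeStr (σ ++ ρ) ≡ codeStr σ + 2 ^ length σ * codeStr ρ
  codeStr-++ [] ρ = sym (+-identityʳ (codeStr ρ))
  codeStr-++ (b ∷ σ) ρ rewrite codeStr-++ σ ρ =
    cong suc (solve 4 (λ c p r t → con 2 :* (c :+ p :* r) :+ t := con 2 :* c :+ t :+ (p :+ (p :+ con 0)) :* r) refl (codeStr σ) (2 ^ length σ) (codeStr ρ) (bit b))

  bit≤1 : ∀ b → bit b ≤ 1
  bit≤1 false = z≤n
  bit≤1 true = s≤s z≤n

  codeStr-lower : ∀ σ → 2 ^ length σ ≤ suc (codeStr σ)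
  codeStr-lower [] = s≤s z≤n
  codeStr-lower (b ∷ σ) = begin
    2 ^ length σ + (2 ^ length σ + 0) ≡⟨ cong (2 ^ length σ +_) (+-identityʳ _) ⟩
    2 ^ length σ + 2 ^ length σ ≤⟨ +-mono-≤ (codeStr-lower σ) (codeStr-lower σ) ⟩
    suc (codeStr σ) + suc (codeStr σ) ≡⟨ solve 2 (λ c t → (con 1 :+ c) :+ (con 1 :+ c) := con 2 :+ con 2 :* c) refl (codeStr σ) (bit b) ⟩
    2 + 2 * codeStr σ ≤⟨ s≤s (m≤m+n (suc (2 * codeStr σ)) (bit b)) ⟩
    suc (suc (2 * codeStr σ + bit b)) ∎
    where open ≤-Reasoning

  codeStr-upper : ∀ σ → suc (codeStr σ) < 2 ^ suc (length σ)
  codeStr-upper [] = s≤s (s≤s z≤n)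
  codeStr-upper (b ∷ σ) = begin-strict
    suc (suc (2 * codeStr σ + bit b)) ≤⟨ s≤s (s≤s (+-monoʳ-≤ (2 * codeStr σ) (bit≤1 b))) ⟩
    suc (suc (2 * codeStr σ + 1)) ≡⟨ solve 1 (λ c → con 2 :+ (con 2 :* c :+ con 1) := con 1 :+ con 2 :* (con 1 :+ c)) refl (codeStr σ) ⟩
    suc (2 * suc (codeStr σ)) <⟨ ≤-reflexive (solve 1 (λ c → con 2 :+ con 2 :* (con 1 :+ c) := con 2 :* (con 2 :+ c)) refl (codeStr σ)) ⟩
    2 * suc (suc (codeStr σ)) ≤⟨ *-monoʳ-≤ 2 (codeStr-upper σ) ⟩
    2 * 2 ^ suc (length σ) ∎
    where open ≤-Reasoning

  codeLength : ℕ → ℕ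
  codeLength zero = 0
  codeLength (suc c) = codeLength c + leq (2 ^ suc (codeLength c)) (suc (suc c))

  codeLength-bounds : ∀ c → 2 ^ codeLength c ≤ suc c × suc c < 2 ^ suc (codeLength c)
  codeLength-bounds zero = s≤s z≤n , s≤s (s≤s z≤n)
  codeLength-bounds (suc c) with codeLength-bounds c | 2 ^ suc (codeLength c) ≤? suc (suc c)
  ... | lo , hi | yes le rewrite leq-yes le | +-comm (codeLength c) 1 = le ,
    (begin-strict suc (suc c) ≤⟨ hi ⟩ 2 ^ suc (codeLength c) <⟨ m<m+n (2 ^ suc (codeLength c)) (m^n>0 2 (suc (codeLength c))) ⟩
       2 ^ suc (codeLength c) + 2 ^ suc (codeLength c) ≡⟨ cong (2 ^ suc (codeLength c) +_) (sym (+-identityʳ _)) ⟩ 2 ^ suc (suc (codeLength c)) ∎)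
    where open ≤-Reasoning
  ... | lo , hi | no nle rewrite leq-no (≰⇒> nle) | +-identityʳ (codeLength c) = ≤-trans lo (n≤1+n (suc c)) , ≰⇒> nle

  pow2-interval-unique : ∀ {a b x} → 2 ^ a ≤ x → x < 2 ^ suc a → 2 ^ b ≤ x → x < 2 ^ suc b → a ≡ b
  pow2-interval-unique {a} {b} {x} la ha lb hb with <-cmp a b
  ... | tri≈ _ e _ = e
  ... | tri< lt _ _ = ⊥-elim (<-irrefl refl (<-≤-trans ha (≤-trans (^-monoʳ-≤ 2 lt) lb)))
  ... | tri> _ _ gt = ⊥-elim (<-irrefl refl (<-≤-trans hb (≤-trans (^-monoʳ-≤ 2 gt) la)))

  codeLength-codeStr : ∀ σ → codeLength (codeStr σ) ≡ length σ
  codeLength-codeStr σ = pow2-interval-unique (proj₁ (codeLength-bounds (codeStr σ))) (proj₂ (codeLength-bounds (codeStr σ))) (codeStr-lower σ) (codeStr-upper σ)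

  bit-injective : ∀ a b x y → 2 * x + bit a ≡ 2 * y + bit b → a ≡ b × x ≡ y
  bit-injective false false x y e = refl , *-cancelˡ-≡ x y 2 (trans (sym (+-identityʳ _)) (trans e (+-identityʳ _)))
  bit-injective true true x y e = refl , *-cancelˡ-≡ x y 2 (+-cancelʳ-≡ _ _ _ e)
  bit-injective false true x y e = ⊥-elim (even≢odd x y (trans (sym (+-identityʳ _)) (trans e (+-comm (2 * y) 1))))
  bit-injective true false x y e = ⊥-elim (even≢odd y x (trans (sym (+-identityʳ _)) (trans (sym e) (+-comm (2 * x) 1))))

  codeStr-injective : ∀ σ τ → codeStr σ ≡ codeStr τ → σ ≡ τ
  codeStr-injective [] [] e = refl
  codeStr-injective (a ∷ σ) (b ∷ τ) e with bit-injective a b (codeStr σ) (codeStr τ) (suc-injective e)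
  ... | refl , e' = cong (a ∷_) (codeStr-injective σ τ e')

  eqn-refl : ∀ x → eqn x x ≡ 1
  eqn-refl x rewrite leq-yes (≤-refl {x}) = refl

  eqn-neq : ∀ {x y} → x ≢ y → eqn x y ≡ 0
  eqn-neq {x} {y} ne with <-cmp x y
  ... | tri< lt _ _ rewrite leq-no lt = *-zeroʳ (leq x y)
  ... | tri≈ _ e _ = ⊥-elim (ne e)
  ... | tri> _ _ gt rewrite leq-no gt = refl

  mod′ : ℕ → ℕ → ℕ
  mod′ zero m = 0
  mod′ (suc x) m = ite (eqn (suc (mod′ x m)) m) 0 (suc (mod′ x m))

  mod′≡% : ∀ x m .{{_ : NonZero m}} → mod′ x m ≡ x % m
  mod′≡% zero (suc m) = refl
  mod′≡% (suc x) m@(suc _) rewrite mod′≡% x m {{_}} = trans step (sym (trans (cong (_% m) e1) ([m+kn]%n≡m%n (suc (x % m)) (x / m) m)))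
    where
    e1 : suc x ≡ suc (x % m) + x / m * m
    e1 = cong suc (m≡m%n+[m/n]*n x m)
    step : ite (eqn (suc (x % m)) m) 0 (suc (x % m)) ≡ suc (x % m) % m
    step with suc (x % m) ≟ m
    ... | yes e = trans (cong (λ k → ite (eqn k m) 0 k) e) (trans (cong (λ q → ite q 0 m) (eqn-refl m)) (sym (trans (cong (_% m) e) (n%n≡0 m))))
    ... | no ne rewrite eqn-neq ne = sym (m<n⇒m%n≡m (≤∧≢⇒< (m%n<n x m) ne))

  -- 1 + codeStr τ ≡ 1 + codeStr (take n τ) ∸ 2^n (mod 2^n), and the right-hand side is below 2^n.
  takeCode : ℕ → ℕ → ℕ
  takeCode c n = mod′ (suc c) (2 ^ n) + 2 ^ n ∸ 1

  takeCode-codeStr : ∀ n τ → n ≤ length τ → takeCode (codeStr τ) n ≡ codeStr (take n τ)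
  takeCode-codeStr n τ le = goal
    where
    instance _ = m^n≢0 2 n
    α = take n τ
    β = drop n τ
    lenα : length α ≡ n
    lenα = trans (length-take n τ) (m≤n⇒m⊓n≡m le)
    eτ : codeStr τ ≡ codeStr α + 2 ^ n * codeStr β
    eτ = trans (cong codeStr (sym (take++drop≡id n τ))) (trans (codeStr-++ α β) (cong (λ k → codeStr α + 2 ^ k * codeStr β) lenα))
    lo : 2 ^ n ≤ suc (codeStr α)
    lo = subst (λ k → 2 ^ k ≤ suc (codeStr α)) lenα (codeStr-lower α)
    hi : suc (codeStr α) < 2 ^ n + 2 ^ n
    hi = subst (λ k → suc (codeStr α) < 2 ^ n + k) (+-identityʳ (2 ^ n)) (subst (λ k → suc (codeStr α) < 2 ^ k + (2 ^ k + 0)) lenα (codeStr-upper α))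
    v = suc (codeStr α) ∸ 2 ^ n
    ev : v + 2 ^ n ≡ suc (codeStr α)
    ev = m∸n+n≡m lo
    vlt : v < 2 ^ n
    vlt = +-cancelʳ-< (2 ^ n) v (2 ^ n) (subst (_< 2 ^ n + 2 ^ n) (sym ev) hi)
    esuc : suc (codeStr τ) ≡ v + suc (codeStr β) * 2 ^ n
    esuc = trans (cong suc eτ) (trans (cong (λ k → k + 2 ^ n * codeStr β) (sym ev))
             (solve 3 (λ v p b → v :+ p :+ p :* b := v :+ (con 1 :+ b) :* p) refl v (2 ^ n) (codeStr β)))
    goal : takeCode (codeStr τ) n ≡ codeStr α
    goal = begin
      mod′ (suc (codeStr τ)) (2 ^ n) + 2 ^ n ∸ 1 ≡⟨ cong (λ k → k + 2 ^ n ∸ 1) (mod′≡% (suc (codeStr τ)) (2 ^ n)) ⟩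
      suc (codeStr τ) % 2 ^ n + 2 ^ n ∸ 1 ≡⟨ cong (λ k → k % 2 ^ n + 2 ^ n ∸ 1) esuc ⟩
      (v + suc (codeStr β) * 2 ^ n) % 2 ^ n + 2 ^ n ∸ 1 ≡⟨ cong (λ k → k + 2 ^ n ∸ 1) ([m+kn]%n≡m%n v (suc (codeStr β)) (2 ^ n)) ⟩
      v % 2 ^ n + 2 ^ n ∸ 1 ≡⟨ cong (λ k → k + 2 ^ n ∸ 1) (m<n⇒m%n≡m vlt) ⟩
      v + 2 ^ n ∸ 1 ≡⟨ cong (_∸ 1) ev ⟩
      codeStr α ∎
      where open ≡-Reasoning

  isPrefixCode : ℕ → ℕ → ℕ
  isPrefixCode s t = leq (codeLength s) (codeLength t) * eqn (takeCode t (codeLength s)) s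

  isPrefixCode-codeStr : ∀ σ τ → isPrefixCode (codeStr σ) (codeStr τ) ≡ bit (isPrefix σ τ)
  isPrefixCode-codeStr σ τ with isPrefix σ τ in eq
  ... | true = begin
      leq (codeLength (codeStr σ)) (codeLength (codeStr τ)) * eqn (takeCode (codeStr τ) (codeLength (codeStr σ))) (codeStr σ)
        ≡⟨ cong₂ (λ a b → leq a b * eqn (takeCode (codeStr τ) a) (codeStr σ)) (codeLength-codeStr σ) (codeLength-codeStr τ) ⟩
      leq (length σ) (length τ) * eqn (takeCode (codeStr τ) (length σ)) (codeStr σ)
        ≡⟨ cong₂ (λ a b → a * eqn b (codeStr σ)) (leq-yes lenle) (trans (takeCode-codeStr (length σ) τ lenle) (cong codeStr tk)) ⟩
      1 * eqn (codeStr σ) (codeStr σ) ≡⟨ cong (1 *_) (eqn-refl (codeStr σ)) ⟩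
      1 ∎
    where
    open ≡-Reasoning
    ρ = drop (length σ) τ
    eτ = isPrefix-split σ τ eq
    lenle : length σ ≤ length τ
    lenle = subst (λ t → length σ ≤ length t) (sym eτ) (subst (length σ ≤_) (sym (length-++ σ)) (m≤m+n (length σ) (length ρ)))
    tk : take (length σ) τ ≡ σ
    tk = subst (λ t → take (length σ) t ≡ σ) (sym eτ) (take-length-++ σ ρ)
  ... | false rewrite codeLength-codeStr σ | codeLength-codeStr τ with length σ ≤? length τ
  ...   | no nle rewrite leq-no (≰⇒> nle) = refl
  ...   | yes le rewrite takeCode-codeStr (length σ) τ le = trans (cong (leq (length σ) (length τ) *_) (eqn-neq ne)) (*-zeroʳ (leq (length σ) (length τ)))
    where
    ne : codeStr (take (length σ) τ) ≢ codeStr σ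
    ne e with trans (trans (sym (isPrefix-++ σ (drop (length σ) τ)))
                           (cong (λ s → isPrefix σ (s ++ drop (length σ) τ)) (sym (codeStr-injective _ _ e))))
                    (trans (cong (isPrefix σ) (take++drop≡id (length σ) τ)) eq)
    ... | ()

  codeLengthF : PRFun 1
  codeLengthF = primRec (uncurry₁ codeLength) (fromTerm (λ _ → 0) (lit 0) λ { [] → refl })
    (fromTerm (uncurry₂ λ k r → r + leq (2 ^ suc r) (suc (suc k)))
       (addF $2 var₁ , (leqF $2 (pow2F $1 (succF $1 var₁)) , (succF $1 (succF $1 var₀))))
       λ { (k ∷ r ∷ []) → refl })
    (λ { [] → refl }) (λ { k [] → refl })

  mod′F : PRFun 2
  mod′F = primRec (uncurry₂ mod′) (fromTerm (λ _ → 0) (lit 0) λ { (m ∷ []) → refl })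
    (fromTerm (uncurry₃ λ k r m → ite (eqn (suc r) m) 0 (suc r)) (app3 iteF (eqF $2 (succF $1 var₁) , var₂) (lit 0) (succF $1 var₁))
       λ { (k ∷ r ∷ m ∷ []) → refl })
    (λ { (m ∷ []) → refl }) (λ { k (m ∷ []) → refl })

  takeCodeF : PRFun 2
  takeCodeF = fromTerm (uncurry₂ takeCode)
    (monusF $2 (addF $2 (mod′F $2 (succF $1 var₀) , (pow2F $1 var₁)) , (pow2F $1 var₁)) , lit 1)
    λ { (c ∷ n ∷ []) → refl }

  isPrefixCodeF : PRFun 2
  isPrefixCodeF = fromTerm (uncurry₂ isPrefixCode)
    (mulF $2 (leqF $2 (codeLengthF $1 var₀) , (codeLengthF $1 var₁)) , (eqF $2 (takeCodeF $2 var₁ , (codeLengthF $1 var₀)) , var₀))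
    λ { (s ∷ t ∷ []) → refl }


  length≤codeStr : ∀ σ → length σ ≤ codeStr σ
  length≤codeStr σ = ≤-pred (≤-trans (n<2^n (length σ)) (codeStr-lower σ))

  maxLen≤codeSet : ∀ l → maxLen l ≤ codeSet l
  maxLen≤codeSet [] = z≤n
  maxLen≤codeSet (σ ∷ l) = m≤n⇒m≤1+n (⊔-lub (≤-trans (length≤codeStr σ) (pair-≥₁ (codeStr σ) (codeSet l)))
                                         (≤-trans (maxLen≤codeSet l) (pair-≥₂ (codeStr σ) (codeSet l))))

  length≤codeSet : ∀ l → length l ≤ codeSet l
  length≤codeSet [] = z≤n
  length≤codeSet (σ ∷ l) = s≤s (≤-trans (length≤codeSet l) (pair-≥₂ (codeStr σ) (codeSet l)))

module StringSum where

  open Arithmetic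
  open import Data.Nat as ℕ using (ℕ; zero; suc; _+_; _*_; _∸_; _^_; _≤_)
  open import Data.Nat.Properties
  open import Data.Bool using (Bool; true; false; T?)
  open import Data.List using (List; []; _∷_; _++_; [_]; length; map; concatMap; filter)
  open import Data.Nat.ListAction using (sum)
  open import Relation.Binary.PropositionalEquality hiding ([_])
  open import Data.Nat.Solver using (module +-*-Solver)
  open +-*-Solver

  swap4 : ∀ a b c d → (a + b) + (c + d) ≡ (a + c) + (b + d)
  swap4 = solve 4 (λ a b c d → (a :+ b) :+ (c :+ d) := (a :+ c) :+ (b :+ d)) refl

  sumStr : (Str → ℕ) → ℕ → ℕ
  sumStr F L = sum (map F (allStrings L))

  sum-prependBit : ∀ (F : Str → ℕ) xs → sum (map F (concatMap (λ τ → (false ∷ τ) ∷ (true ∷ τ) ∷ []) xs))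
    ≡ sum (map (λ τ → F (false ∷ τ)) xs) + sum (map (λ τ → F (true ∷ τ)) xs)
  sum-prependBit F [] = refl
  sum-prependBit F (τ ∷ xs) rewrite sum-prependBit F xs =
    solve 4 (λ a b c d → a :+ (b :+ (c :+ d)) := (a :+ c) :+ (b :+ d)) refl (F (false ∷ τ)) (F (true ∷ τ)) (sum (map (λ τ → F (false ∷ τ)) xs)) (sum (map (λ τ → F (true ∷ τ)) xs))

  sumStr-suc : ∀ F L → sumStr F (suc L) ≡ sumStr (λ τ → F (false ∷ τ)) L + sumStr (λ τ → F (true ∷ τ)) L
  sumStr-suc F L = sum-prependBit F (allStrings L)

  sumStr-cong : ∀ {F G} L → (∀ ρ → length ρ ≡ L → F ρ ≡ G ρ) → sumStr F L ≡ sumStr G L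
  sumStr-cong {F} {G} zero h = cong (_+ 0) (h [] refl)
  sumStr-cong {F} {G} (suc L) h rewrite sumStr-suc F L | sumStr-suc G L =
    cong₂ _+_ (sumStr-cong L (λ ρ e → h (false ∷ ρ) (cong suc e))) (sumStr-cong L (λ ρ e → h (true ∷ ρ) (cong suc e)))


  sumStr-const : ∀ c L → sumStr (λ _ → c) L ≡ 2 ^ L * c
  sumStr-const c zero = refl
  sumStr-const c (suc L) rewrite sumStr-suc (λ _ → c) L | sumStr-const c L =
    solve 2 (λ p c → p :* c :+ p :* c := (p :+ (p :+ con 0)) :* c) refl (2 ^ L) c

  sumStr-split : ∀ F n z → sumStr F (n + z) ≡ sumStr (λ σ → sumStr (λ ρ → F (σ ++ ρ)) z) n
  sumStr-split F zero z = sym (+-identityʳ _)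
  sumStr-split F (suc n) z rewrite sumStr-suc F (n + z) | sumStr-suc (λ σ → sumStr (λ ρ → F (σ ++ ρ)) z) n =
    cong₂ _+_ (sumStr-split (λ τ → F (false ∷ τ)) n z) (sumStr-split (λ τ → F (true ∷ τ)) n z)

  sumStr-snoc : ∀ F L → sumStr F (suc L) ≡ sumStr (λ ρ → F (ρ ++ [ false ])) L + sumStr (λ ρ → F (ρ ++ [ true ])) L
  sumStr-snoc F zero = solve 2 (λ a b → a :+ (b :+ con 0) := (a :+ con 0) :+ (b :+ con 0)) refl (F (false ∷ [])) (F (true ∷ []))
  sumStr-snoc F (suc L) rewrite sumStr-suc F (suc L) | sumStr-snoc (λ τ → F (false ∷ τ)) L | sumStr-snoc (λ τ → F (true ∷ τ)) L
    | sumStr-suc (λ ρ → F (ρ ++ [ false ])) L | sumStr-suc (λ ρ → F (ρ ++ [ true ])) L =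
    swap4 (sumStr (λ ρ → F (false ∷ (ρ ++ [ false ]))) L) (sumStr (λ ρ → F (false ∷ (ρ ++ [ true ]))) L)
          (sumStr (λ ρ → F (true ∷ (ρ ++ [ false ]))) L) (sumStr (λ ρ → F (true ∷ (ρ ++ [ true ]))) L)



  length-filter-bit : ∀ (p : Str → Bool) xs → length (filter (λ τ → T? (p τ)) xs) ≡ sum (map (λ τ → bit (p τ)) xs)
  length-filter-bit p [] = refl
  length-filter-bit p (x ∷ xs) with p x
  ... | true = cong suc (length-filter-bit p xs)
  ... | false = length-filter-bit p xs

  range : ℕ → ℕ → List ℕ
  range a zero = []
  range a (suc N) = a ∷ range (suc a) N

  dbl : ℕ → List ℕ
  dbl c = suc (2 * c + 0) ∷ suc (2 * c + 1) ∷ []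

  dbl2 : ∀ N → 2 * suc N ≡ suc (suc (2 * N))
  dbl2 N = solve 1 (λ n → con 2 :* (con 1 :+ n) := con 2 :+ con 2 :* n) refl N

  range-dbl : ∀ a N → concatMap dbl (range a N) ≡ range (suc (2 * a)) (2 * N)
  range-dbl a zero = refl
  range-dbl a (suc N) rewrite range-dbl (suc a) N = trans (
    cong₃ (λ x y z → x ∷ y ∷ range z (2 * N)) (cong suc (+-identityʳ (2 * a))) (cong suc (+-comm (2 * a) 1))
      (solve 1 (λ a → con 1 :+ con 2 :* (con 1 :+ a) := con 3 :+ con 2 :* a) refl a))
      (cong (range (suc (2 * a))) (sym (dbl2 N)))
    where
    cong₃ : ∀ {A B C D : Set} (f : A → B → C → D) {x x' y y' z z'} → x ≡ x' → y ≡ y' → z ≡ z' → f x y z ≡ f x' y' z'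
    cong₃ f refl refl refl = refl

  map-concatMap : ∀ xs → map codeStr (concatMap (λ τ → (false ∷ τ) ∷ (true ∷ τ) ∷ []) xs) ≡ concatMap dbl (map codeStr xs)
  map-concatMap [] = refl
  map-concatMap (τ ∷ xs) = cong (λ r → suc (2 * codeStr τ + 0) ∷ suc (2 * codeStr τ + 1) ∷ r) (map-concatMap xs)

  map-codeStr-allStrings : ∀ L → map codeStr (allStrings L) ≡ range (2 ^ L ∸ 1) (2 ^ L)
  map-codeStr-allStrings zero = refl
  map-codeStr-allStrings (suc L) rewrite map-concatMap (allStrings L) | map-codeStr-allStrings L | range-dbl (2 ^ L ∸ 1) (2 ^ L) =
    cong (λ k → range k (2 * 2 ^ L)) e
    where
    p = 2 ^ L
    pos : 1 ≤ p
    pos = m^n>0 2 L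
    e : suc (2 * (p ∸ 1)) ≡ 2 * p ∸ 1
    e = begin
      suc (2 * (p ∸ 1)) ≡⟨ cong suc (*-distribˡ-∸ 2 p 1) ⟩
      suc (2 * p ∸ 2) ≡⟨ sym (+-∸-assoc 1 (*-monoʳ-≤ 2 pos)) ⟩
      1 + 2 * p ∸ 2 ≡⟨⟩
      2 * p ∸ 1 ∎
      where open ≡-Reasoning



  sum-range : ∀ (F : ℕ → ℕ) a N → sum (map F (range a N)) ≡ sumTo (λ r → F (a + r)) N
  sum-range F a zero = refl
  sum-range F a (suc N) rewrite sum-range F (suc a) N =
    sym (trans (sumTo-head (λ r → F (a + r)) N) (cong₂ _+_ (cong F (+-identityʳ a)) (sumTo-cong N (λ r _ → cong F (+-suc a r)))))

  sumStr-codeStr : ∀ (F : ℕ → ℕ) L → sumStr (λ ρ → F (codeStr ρ)) L ≡ sumTo (λ r → F (2 ^ L ∸ 1 + r)) (2 ^ L)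
  sumStr-codeStr F L = trans (cong sum (map-∘ (allStrings L))) (trans (cong (λ l → sum (map F l)) (map-codeStr-allStrings L)) (sum-range F (2 ^ L ∸ 1) (2 ^ L)))
    where
    map-∘ : ∀ xs → map (λ ρ → F (codeStr ρ)) xs ≡ map F (map codeStr xs)
    map-∘ [] = refl
    map-∘ (x ∷ xs) = cong (F (codeStr x) ∷_) (map-∘ xs)

  ≤sumStr : ∀ (F : Str → ℕ) τ → F τ ≤ sumStr F (length τ)
  ≤sumStr F [] = m≤m+n (F []) 0
  ≤sumStr F (false ∷ τ) rewrite sumStr-suc F (length τ) = ≤-trans (≤sumStr (λ ρ → F (false ∷ ρ)) τ) (m≤m+n _ _)
  ≤sumStr F (true ∷ τ) rewrite sumStr-suc F (length τ) = ≤-trans (≤sumStr (λ ρ → F (true ∷ ρ)) τ) (m≤n+m _ _)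

module FilterCode where

  open PrimRec
  open Pairing using (pairF)
  open StringSum using (range; map-codeStr-allStrings)
  open import Data.Nat using (ℕ; zero; suc; _+_; _∸_; _^_; _≤_; s≤s)
  open import Data.Nat.Properties using (≤-trans; n≤1+n; m≤n+m; m+n∸n≡m)
  open import Data.Bool using (Bool; true; false; T?)
  open import Data.List using ([]; _∷_; map; filter)
  open import Data.Vec using ([]; _∷_)
  open import Function using (_∘_)
  open import Relation.Binary.PropositionalEquality

  isOne : ℕ → Bool
  isOne zero = false
  isOne (suc _) = true

  filterRangeCode : (ℕ → ℕ → ℕ) → ℕ → ℕ → ℕ → ℕ
  filterRangeCode p zero b n = 0
  filterRangeCode p (suc k) b n =
    ite (p n (b ∸ suc k)) (suc (pair (b ∸ suc k) (filterRangeCode p k b n))) (filterRangeCode p k b n)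

  suc[m∸1+n]≡m∸n : ∀ m n → suc n ≤ m → suc (m ∸ suc n) ≡ m ∸ n
  suc[m∸1+n]≡m∸n (suc m) zero _ = refl
  suc[m∸1+n]≡m∸n (suc m) (suc n) (s≤s le) = suc[m∸1+n]≡m∸n m n le

  filterRangeCode-correct : ∀ p k b n → k ≤ b →
    filterRangeCode p k b n ≡ codeList (filter (λ c → T? (isOne (p n c))) (range (b ∸ k) k))
  filterRangeCode-correct p zero b n _ = refl
  filterRangeCode-correct p (suc k) b n le rewrite suc[m∸1+n]≡m∸n b k le with p n (b ∸ suc k)
  ... | zero = filterRangeCode-correct p k b n (≤-trans (n≤1+n k) le)
  ... | suc _ = cong (λ r → suc (pair (b ∸ suc k) r)) (filterRangeCode-correct p k b n (≤-trans (n≤1+n k) le))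

  map-codeStr-filter : ∀ (q : ℕ → Bool) xs →
    map codeStr (filter (λ σ → T? (q (codeStr σ))) xs) ≡ filter (λ c → T? (q c)) (map codeStr xs)
  map-codeStr-filter q [] = refl
  map-codeStr-filter q (x ∷ xs) with q (codeStr x)
  ... | true = cong (codeStr x ∷_) (map-codeStr-filter q xs)
  ... | false = map-codeStr-filter q xs

  codeSet-filter-allStrings : ∀ p L n →
    codeSet (filter (λ σ → T? (isOne (p n (codeStr σ)))) (allStrings L)) ≡ filterRangeCode p (2 ^ L) (2 ^ L ∸ 1 + 2 ^ L) n
  codeSet-filter-allStrings p L n = begin
    codeList (map codeStr (filter (λ σ → T? (q (codeStr σ))) (allStrings L)))
      ≡⟨ cong codeList (map-codeStr-filter q (allStrings L)) ⟩
    codeList (filter (λ c → T? (q c)) (map codeStr (allStrings L)))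
      ≡⟨ cong (λ l → codeList (filter (λ c → T? (q c)) l)) (map-codeStr-allStrings L) ⟩
    codeList (filter (λ c → T? (q c)) (range (2 ^ L ∸ 1) (2 ^ L)))
      ≡⟨ cong (λ a → codeList (filter (λ c → T? (q c)) (range a (2 ^ L)))) (sym (m+n∸n≡m (2 ^ L ∸ 1) (2 ^ L))) ⟩
    codeList (filter (λ c → T? (q c)) (range (2 ^ L ∸ 1 + 2 ^ L ∸ 2 ^ L) (2 ^ L)))
      ≡⟨ sym (filterRangeCode-correct p (2 ^ L) (2 ^ L ∸ 1 + 2 ^ L) n (m≤n+m (2 ^ L) (2 ^ L ∸ 1))) ⟩
    filterRangeCode p (2 ^ L) (2 ^ L ∸ 1 + 2 ^ L) n ∎
    where
    open ≡-Reasoning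
    q : ℕ → Bool
    q = isOne ∘ p n

  filterRangeCodeF : (F : PRFun 2) → PRFun 3
  filterRangeCodeF F = primRec (uncurry₃ (filterRangeCode p)) (fromTerm (λ _ → 0) (lit 0) λ { (b ∷ n ∷ []) → refl })
    (fromTerm (λ { (k ∷ r ∷ b ∷ n ∷ []) → ite (p n (b ∸ suc k)) (suc (pair (b ∸ suc k) r)) r })
       (app3 iteF (F $2 var₃ , (monusF $2 var₂ , (succF $1 var₀))) (succF $1 (pairF $2 (monusF $2 var₂ , (succF $1 var₀)) , var₁)) var₁)
       λ { (k ∷ r ∷ b ∷ n ∷ []) → refl })
    (λ { (b ∷ n ∷ []) → refl }) (λ { k (b ∷ n ∷ []) → refl })
    where
    p : ℕ → ℕ → ℕ
    p n c = fn F (n ∷ c ∷ [])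

module Kolmogorov where

  open PrimRec using (leq; leq-yes; leq-no)
  open FilterCode using (isOne)
  open StringSum
  open import Data.Nat using (ℕ; zero; suc; _+_; _*_; _^_; _≤_; _≤?_; z≤n; NonZero)
  open import Data.Nat.Properties
  open import Data.Bool using (Bool; true; false)
  open import Data.List using (_++_; [_])
  open import Data.List.Properties using (++-identityʳ; ++-assoc)
  open import Relation.Nullary using (yes; no)
  open import Relation.Binary.PropositionalEquality hiding ([_])
  open import Data.Nat.Solver using (module +-*-Solver)
  open +-*-Solver

  module _
    (a b : Str → ℕ) (b≢0 : ∀ σ → NonZero (b σ))
    (fair : ∀ σ → a σ * (2 * (b (σ ++ [ false ]) * b (σ ++ [ true ])))
                ≡ (a (σ ++ [ false ]) * b (σ ++ [ true ]) + a (σ ++ [ true ]) * b (σ ++ [ false ])) * b σ)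
    where

    large : ℕ → Str → Bool
    large n σ = isOne (leq (2 ^ n * b σ) (a σ))

    large⇒ : ∀ {n σ} → large n σ ≡ true → 2 ^ n * b σ ≤ a σ
    large⇒ {n} {σ} e with 2 ^ n * b σ ≤? a σ
    ... | yes le = le
    ... | no nle rewrite leq-no (≰⇒> nle) with e
    ...   | ()

    ⇒large : ∀ {n σ} → 2 ^ n * b σ ≤ a σ → large n σ ≡ true
    ⇒large le rewrite leq-yes le = refl

    kolmogorov : ∀ n L σ → sumStr (λ ρ → bit (large n (σ ++ ρ))) L * 2 ^ n * b σ ≤ 2 ^ L * a σ
    kolmogorov n zero σ rewrite ++-identityʳ σ with large n σ in e
    ... | false = z≤n
    ... | true = subst₂ _≤_ (cong (_* b σ) (sym (*-identityˡ (2 ^ n)))) (sym (*-identityˡ (a σ))) (large⇒ {n} e)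
    kolmogorov n (suc L) σ = *-cancelʳ-≤ _ _ (b₀ * b₁) {{m*n≢0 b₀ b₁ {{b≢0 σ₀}} {{b≢0 σ₁}}}} (begin
        sumStr F (suc L) * 2 ^ n * b σ * (b₀ * b₁)
          ≡⟨ cong (λ c → c * 2 ^ n * b σ * (b₀ * b₁)) split ⟩
        (c₀ + c₁) * 2 ^ n * b σ * (b₀ * b₁)
          ≡⟨ solve 6 (λ c₀ c₁ P B b₀ b₁ → (c₀ :+ c₁) :* P :* B :* (b₀ :* b₁)
                                        := c₀ :* P :* b₀ :* (b₁ :* B) :+ c₁ :* P :* b₁ :* (b₀ :* B)) refl c₀ c₁ (2 ^ n) (b σ) b₀ b₁ ⟩
        c₀ * 2 ^ n * b₀ * (b₁ * b σ) + c₁ * 2 ^ n * b₁ * (b₀ * b σ)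
          ≤⟨ +-mono-≤ (*-monoˡ-≤ (b₁ * b σ) (kolmogorov n L σ₀)) (*-monoˡ-≤ (b₀ * b σ) (kolmogorov n L σ₁)) ⟩
        2 ^ L * a₀ * (b₁ * b σ) + 2 ^ L * a₁ * (b₀ * b σ)
          ≡⟨ solve 6 (λ Q a₀ a₁ b₀ b₁ B → Q :* a₀ :* (b₁ :* B) :+ Q :* a₁ :* (b₀ :* B) := Q :* ((a₀ :* b₁ :+ a₁ :* b₀) :* B))
                     refl (2 ^ L) a₀ a₁ b₀ b₁ (b σ) ⟩
        2 ^ L * ((a₀ * b₁ + a₁ * b₀) * b σ)
          ≡⟨ cong (2 ^ L *_) (sym (fair σ)) ⟩
        2 ^ L * (a σ * (2 * (b₀ * b₁)))
          ≡⟨ solve 4 (λ Q A b₀ b₁ → Q :* (A :* (con 2 :* (b₀ :* b₁))) := (Q :+ (Q :+ con 0)) :* A :* (b₀ :* b₁)) refl (2 ^ L) (a σ) b₀ b₁ ⟩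
        2 ^ suc L * a σ * (b₀ * b₁) ∎)
      where
      open ≤-Reasoning
      σ₀ = σ ++ [ false ]
      σ₁ = σ ++ [ true ]
      a₀ = a σ₀
      a₁ = a σ₁
      b₀ = b σ₀
      b₁ = b σ₁
      F : Str → ℕ
      F ρ = bit (large n (σ ++ ρ))
      c₀ = sumStr (λ ρ → bit (large n (σ₀ ++ ρ))) L
      c₁ = sumStr (λ ρ → bit (large n (σ₁ ++ ρ))) L
      split : sumStr F (suc L) ≡ c₀ + c₁
      split = trans (sumStr-suc F L)
        (cong₂ _+_ (sumStr-cong L (λ ρ _ → cong (λ s → bit (large n s)) (sym (++-assoc σ [ false ] ρ))))
                   (sumStr-cong L (λ ρ _ → cong (λ s → bit (large n s)) (sym (++-assoc σ [ true ] ρ)))))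

module UniformMeasure where

  open Fraction
  open Strings
  open StringSum
  open import Data.Nat using (_*_; _^_; _≤_; z≤n)
  open import Data.Nat.Properties using (m^n≢0; m≥n⇒m⊔n≡m; ⊔-idem; +-identityʳ)
  open import Data.Bool using (Bool; true; false; T; T?)
  open import Data.Bool.ListAction using (any)
  open import Data.List using ([]; _∷_; length; filter)
  open import Data.List.Membership.Propositional using (_∈_)
  open import Data.List.Membership.Propositional.Properties using (∈-filter⁺; ∈-filter⁻)
  open import Data.List.Relation.Unary.Any using (here; there)
  open import Data.Product using (_,_; proj₁)
  open import Data.Rational as ℚ using ()
  open import Relation.Binary.PropositionalEquality

  maxLen-sameLength : ∀ L σ G → (∀ {τ} → τ ∈ σ ∷ G → length τ ≡ L) → maxLen (σ ∷ G) ≡ L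
  maxLen-sameLength L σ [] h = trans (m≥n⇒m⊔n≡m z≤n) (h (here refl))
  maxLen-sameLength L σ (σ′ ∷ G) h
    rewrite maxLen-sameLength L σ′ G (λ m → h (there m)) | h (here refl) = ⊔-idem L

  covered-filter-allStrings : ∀ (q : Str → Bool) L τ → length τ ≡ L →
    any (λ σ → isPrefix σ τ) (filter (λ σ → T? (q σ)) (allStrings L)) ≡ q τ
  covered-filter-allStrings q L τ e
    with q τ in qτ | any (λ σ → isPrefix σ τ) (filter (λ σ → T? (q σ)) (allStrings L)) in cov
  ... | true | true = refl
  ... | false | false = refl
  ... | true | false
    with trans (sym (any-intro (λ σ → isPrefix σ τ) (∈-filter⁺ (λ σ → T? (q σ)) (∈-allStrings⁺ L τ e) (subst T (sym qτ) _))
                               (isPrefix-refl τ))) cov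
  ...   | ()
  covered-filter-allStrings q L τ e | false | true
    with any-elim (λ σ → isPrefix σ τ) (filter (λ σ → T? (q σ)) (allStrings L)) cov
  ... | σ , σ∈ , σ⊑τ with ∈-filter⁻ (λ σ → T? (q σ)) σ∈
  ...   | σ∈all , qσ with isPrefix-sameLength σ τ (trans (∈-allStrings⁻ L σ σ∈all) (sym e)) σ⊑τ
  ...     | refl with subst T qτ qσ
  ...       | ()

  μ-filter-allStrings : ∀ (q : Str → Bool) L n → sumStr (λ τ → bit (q τ)) L * 2 ^ n ≤ 2 ^ L →
    μ (filter (λ σ → T? (q σ)) (allStrings L)) ℚ.≤ 2^- n
  μ-filter-allStrings q L n bound with filter (λ σ → T? (q σ)) (allStrings L) in eq
  ... | [] = frac-≤ 0 1 1 (2 ^ n) {{_}} {{m^n≢0 2 n}} z≤n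
  ... | σ ∷ G = frac-≤ (countCovered (σ ∷ G) M) (2 ^ M) 1 (2 ^ n) {{m^n≢0 2 M}} {{m^n≢0 2 n}} count-bound
    where
    M = maxLen (σ ∷ G)
    M≡L : M ≡ L
    M≡L = maxLen-sameLength L σ G
      (λ {τ} m → ∈-allStrings⁻ L τ (proj₁ (∈-filter⁻ (λ σ → T? (q σ)) (subst (τ ∈_) (sym eq) m))))
    count≡ : countCovered (σ ∷ G) L ≡ sumStr (λ τ → bit (q τ)) L
    count≡ = trans (length-filter-bit (λ τ → any (λ σ → isPrefix σ τ) (σ ∷ G)) (allStrings L))
      (sumStr-cong L (λ τ e → cong bit (trans (cong (any (λ σ → isPrefix σ τ)) (sym eq)) (covered-filter-allStrings q L τ e))))
    count-bound : countCovered (σ ∷ G) M * 2 ^ n ≤ 1 * 2 ^ M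
    count-bound rewrite M≡L | count≡ | +-identityʳ (2 ^ L) = bound

module MartingaleToTest where

  open Fraction
  open PrimRec
  open Pairing using (π₁F; π₂F; π₁-pair; π₂-pair)
  open Strings
  open FilterCode
  open Kolmogorov
  open UniformMeasure
  open StringSum using (sumStr)
  open import Data.Nat using (ℕ; suc; _+_; _*_; _∸_; _^_; _≤_)
  open import Data.Nat.Properties
  open import Data.Bool using (Bool; true; false; T; T?)
  open import Data.List using (List; []; _++_; [_]; filter)
  open import Data.List.Membership.Propositional.Properties using (∈-filter⁺)
  open import Data.Vec using ([]; _∷_)
  open import Data.Product using (_,_; proj₁; proj₂)
  open import Data.Integer using (+_)
  open import Data.Rational as ℚ using (½)
  open import Relation.Binary.PropositionalEquality hiding ([_])

  module _ (d : Str → ℚ.ℚ) (isM : IsMartingale d) (num den : ℕ → ℕ)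
           (num,den-pr : IsPrimRec (λ c → pair (num c) (den c)))
           (d≡ : ∀ σ → d σ ≡ (+ num (codeStr σ)) ℚ./ suc (den (codeStr σ)))
           (f : ℕ → ℕ) (f-pr : IsPrimRec f) where

    a b : Str → ℕ
    a σ = num (codeStr σ)
    b σ = suc (den (codeStr σ))

    fair-cross : ∀ σ → a σ * (2 * (b (σ ++ [ false ]) * b (σ ++ [ true ])))
                     ≡ (a (σ ++ [ false ]) * b (σ ++ [ true ]) + a (σ ++ [ true ]) * b (σ ++ [ false ])) * b σ
    fair-cross σ = trans (frac-≡⁻ (a σ) (b σ) (1 * (a σ₀ * b σ₁ + a σ₁ * b σ₀)) (2 * (b σ₀ * b σ₁)) (begin
      frac (a σ) (b σ)                                          ≡⟨ sym (d≡ σ) ⟩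
      d σ                                                       ≡⟨ IsMartingale.fair isM σ ⟩
      ½ ℚ.* (d σ₀ ℚ.+ d σ₁)                                     ≡⟨ cong₂ (λ x y → ½ ℚ.* (x ℚ.+ y)) (d≡ σ₀) (d≡ σ₁) ⟩
      frac 1 2 ℚ.* (frac (a σ₀) (b σ₀) ℚ.+ frac (a σ₁) (b σ₁))  ≡⟨ cong (frac 1 2 ℚ.*_) (frac-+ (a σ₀) (b σ₀) (a σ₁) (b σ₁)) ⟩
      frac 1 2 ℚ.* frac (a σ₀ * b σ₁ + a σ₁ * b σ₀) (b σ₀ * b σ₁) ≡⟨ frac-* 1 2 (a σ₀ * b σ₁ + a σ₁ * b σ₀) (b σ₀ * b σ₁) ⟩
      frac (1 * (a σ₀ * b σ₁ + a σ₁ * b σ₀)) (2 * (b σ₀ * b σ₁)) ∎))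
      (cong (_* b σ) (*-identityˡ (a σ₀ * b σ₁ + a σ₁ * b σ₀)))
      where
      open ≡-Reasoning
      σ₀ = σ ++ [ false ]
      σ₁ = σ ++ [ true ]

    a[]≡b[] : a [] ≡ b []
    a[]≡b[] = trans (sym (*-identityʳ (a [])))
      (trans (frac-≡⁻ (a []) (b []) 1 1 (trans (sym (d≡ [])) (IsMartingale.root isM))) (*-identityˡ (b [])))

    large′ : ℕ → Str → Bool
    large′ = large a b (λ _ → _) fair-cross

    G : ℕ → List Str
    G n = filter (λ σ → T? (large′ n σ)) (allStrings (f n))

    G-small : ∀ n → μ (G n) ℚ.≤ 2^- n
    G-small n = μ-filter-allStrings (large′ n) (f n) n (*-cancelʳ-≤ _ _ (b [])
      (subst (λ x → sumStr (λ τ → bit (large′ n τ)) (f n) * 2 ^ n * b [] ≤ 2 ^ f n * x) a[]≡b[] (kolmogorov a b (λ _ → _) fair-cross n (f n) [])))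

    G-primrec : IsPrimRec (λ n → codeSet (G n))
    G-primrec = proj₁ (toIsPrimRec codeF) , λ n → trans (proj₂ (toIsPrimRec codeF) n) (sym (codeSet-filter-allStrings largeCode (f n) n))
      where
      largeCode : ℕ → ℕ → ℕ
      largeCode n c = leq (2 ^ n * suc (den c)) (num c)
      num,denF numF denF fF : PRFun 1
      num,denF = fromIsPrimRec num,den-pr
      numF = fromTerm (uncurry₁ num) (π₁F $1 (num,denF $1 var₀)) λ { (c ∷ []) → π₁-pair (num c) (den c) }
      denF = fromTerm (uncurry₁ den) (π₂F $1 (num,denF $1 var₀)) λ { (c ∷ []) → π₂-pair (num c) (den c) }
      fF = fromIsPrimRec f-pr
      largeCodeF : PRFun 2
      largeCodeF = fromTerm (uncurry₂ largeCode)
        (leqF $2 (mulF $2 (pow2F $1 var₀) , (succF $1 (denF $1 var₁))) , (numF $1 var₁)) λ { (n ∷ c ∷ []) → refl }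
      codeF : PRFun 1
      codeF = fromTerm (uncurry₁ λ n → filterRangeCode largeCode (2 ^ f n) (2 ^ f n ∸ 1 + 2 ^ f n) n)
        (app3 (filterRangeCodeF largeCodeF) (pow2F $1 (fF $1 var₀))
              (addF $2 (monusF $2 (pow2F $1 (fF $1 var₀)) , lit 1) , (pow2F $1 (fF $1 var₀))) var₀)
        λ { (n ∷ []) → refl }

    test : PRTest
    test = record { G = G ; primrec = G-primrec ; small = G-small }

    succeeds⇒∈G : ∀ X → (∀ n → (+ (2 ^ n)) ℚ./ 1 ℚ.≤ d (X ↾ f n)) → ∀ n → X ∈[ G n ]
    succeeds⇒∈G X succeeds n =
      σ , ∈-filter⁺ (λ σ → T? (large′ n σ)) (∈-allStrings⁺ (f n) σ (length-↾ X (f n))) (subst T (sym isLarge) _) ,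
      cong (X ↾_) (length-↾ X (f n))
      where
      σ = X ↾ f n
      isLarge : large′ n σ ≡ true
      isLarge = ⇒large a b (λ _ → _) fair-cross {n} (subst (2 ^ n * b σ ≤_) (*-identityʳ (a σ))
        (frac-≤⁻ (2 ^ n) 1 (a σ) (b σ) (subst ((+ (2 ^ n)) ℚ./ 1 ℚ.≤_) (d≡ σ) (succeeds n))))

  mlRandom⇒martingaleRandom : ∀ X → MLBPRandom X → MartingaleBPRandom X
  mlRandom⇒martingaleRandom X ml (d , isM , (num , den , num,den-pr , d≡) , (f , f-pr , succeeds)) =
    ml (test d isM num den num,den-pr d≡ f f-pr) (succeeds⇒∈G d isM num den num,den-pr d≡ f f-pr X succeeds)

module PrefixCover where

  open PrimRec
  open Pairing
  open StringCode
  open StringSum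
  open Strings
  open Arithmetic
  open import Data.Nat as ℕ using (ℕ; zero; suc; _+_; _*_; _∸_; _≤_; s≤s)
  open import Data.Nat.Properties
  open import Data.Bool using (Bool; true; false)
  open import Data.Bool.ListAction using (any)
  open import Data.List using (List; []; _∷_; length; map)
  open import Data.Nat.ListAction using (sum)
  open import Data.Vec using ([]; _∷_)
  open import Relation.Binary.PropositionalEquality hiding ([_])

  tailCode : ℕ → ℕ
  tailCode y = π₂ (y ∸ 1)

  headCode : ℕ → ℕ
  headCode y = π₁ (y ∸ 1)

  dropCode : ℕ → ℕ → ℕ
  dropCode z j = iter tailCode j z

  prefixTerm : ℕ → ℕ → ℕ
  prefixTerm t y = sg y * isPrefixCode (headCode y) t

  countPrefixes : ℕ → ℕ → ℕ
  countPrefixes z t = sumTo (λ j → prefixTerm t (dropCode z j)) z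

  covers : ℕ → ℕ → ℕ
  covers z t = leq 1 (countPrefixes z t)

  iter-suc : ∀ (g : ℕ → ℕ) j x → iter g (suc j) x ≡ iter g j (g x)
  iter-suc g zero x = refl
  iter-suc g (suc j) x = cong g (iter-suc g j x)

  iter-tailCode-0 : ∀ j → iter tailCode j 0 ≡ 0
  iter-tailCode-0 zero = refl
  iter-tailCode-0 (suc j) rewrite iter-tailCode-0 j = refl


  countPrefixesList : List Str → ℕ → ℕ
  countPrefixesList [] t = 0
  countPrefixesList (σ ∷ l) t = isPrefixCode (codeStr σ) t + countPrefixesList l t

  countPrefixes-codeSet : ∀ l t F → length l ≤ F → sumTo (λ j → prefixTerm t (dropCode (codeSet l) j)) F ≡ countPrefixesList l t
  countPrefixes-codeSet [] t F _ = sumTo-zero _ F (λ j → cong (prefixTerm t) (iter-tailCode-0 j))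
  countPrefixes-codeSet (σ ∷ l) t (suc F) (s≤s le) =
    trans (sumTo-head (λ j → prefixTerm t (dropCode z j)) F)
      (cong₂ _+_ head≡ (trans (sumTo-cong F (λ j _ → trans (cong (prefixTerm t) (iter-suc tailCode j z)) (cong (λ y → prefixTerm t (iter tailCode j y)) tail≡)))
                           (countPrefixes-codeSet l t F le)))
    where
    z = codeSet (σ ∷ l)
    tail≡ : tailCode z ≡ codeSet l
    tail≡ = π₂-pair (codeStr σ) (codeSet l)
    head≡ : prefixTerm t z ≡ isPrefixCode (codeStr σ) t
    head≡ = trans (+-identityʳ _) (cong (λ x → isPrefixCode x t) (π₁-pair (codeStr σ) (codeSet l)))


  countPrefixesList-codeStr : ∀ l τ → countPrefixesList l (codeStr τ) ≡ sum (map (λ σ → bit (isPrefix σ τ)) l)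
  countPrefixesList-codeStr [] τ = refl
  countPrefixesList-codeStr (σ ∷ l) τ = cong₂ _+_ (isPrefixCode-codeStr σ τ) (countPrefixesList-codeStr l τ)

  leq1-sum-bit : ∀ (p : Str → Bool) l → leq 1 (sum (map (λ σ → bit (p σ)) l)) ≡ bit (any p l)
  leq1-sum-bit p [] = refl
  leq1-sum-bit p (σ ∷ l) with p σ
  ... | true = cong nsg (0∸n≡0 (sum (map (λ σ → bit (p σ)) l)))
  ... | false = leq1-sum-bit p l

  covers-codeSet : ∀ l τ → covers (codeSet l) (codeStr τ) ≡ bit (any (λ σ → isPrefix σ τ) l)
  covers-codeSet l τ = trans (cong (leq 1) (trans (countPrefixes-codeSet l (codeStr τ) (codeSet l) (length≤codeSet l)) (countPrefixesList-codeStr l τ)))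
                      (leq1-sum-bit (λ σ → isPrefix σ τ) l)

  tailCodeF : PRFun 1
  tailCodeF = fromTerm (uncurry₁ tailCode) (π₂F $1 (monusF $2 var₀ , lit 1)) λ { (y ∷ []) → refl }

  headCodeF : PRFun 1
  headCodeF = fromTerm (uncurry₁ headCode) (π₁F $1 (monusF $2 var₀ , lit 1)) λ { (y ∷ []) → refl }

  dropCodeF : PRFun 2
  dropCodeF = iterF tailCodeF

  prefixTermF : PRFun 3
  prefixTermF = fromTerm (uncurry₃ λ j z t → prefixTerm t (dropCode z j))
    (mulF $2 (sgF $1 (dropCodeF $2 var₀ , var₁)) , (isPrefixCodeF $2 (headCodeF $1 (dropCodeF $2 var₀ , var₁)) , var₂))
    λ { (j ∷ z ∷ t ∷ []) → refl }

  countPrefixesF : PRFun 2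
  countPrefixesF = fromTerm (uncurry₂ countPrefixes)
    (app3 (sumF prefixTermF) var₀ var₀ var₁)
    λ { (z ∷ t ∷ []) → refl }

  coversF : PRFun 2
  coversF = fromTerm (uncurry₂ covers)
    (leqF $2 lit 1 , (countPrefixesF $2 var₀ , var₁))
    λ { (z ∷ t ∷ []) → refl }


module CoverMartingale where

  open Fraction
  open Arithmetic
  open StringCode
  open StringSum
  open Strings
  open import Data.Nat as ℕ using (ℕ; zero; suc; _+_; _*_; _∸_; _^_; _≤_; _<_; s≤s)
  open import Data.Nat.Properties
  open import Data.Bool using (Bool; true; false)
  open import Data.Bool.ListAction using (any)
  open import Data.List using (List; []; _∷_; _++_; [_]; length; take)
  open import Data.List.Properties using (length-++; ++-assoc; take-all)
  open import Data.List.Membership.Propositional using (_∈_)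
  open import Data.Product using (_,_)
  open import Data.Rational as ℚ using ()
  open import Relation.Binary.PropositionalEquality hiding ([_])
  open import Data.Nat.Solver using (module +-*-Solver)
  open +-*-Solver

  module Numerator (U : ℕ → List Str) (U-small : ∀ k → μ (U k) ℚ.≤ 2^- k) where

    level : ℕ → ℕ
    level n = suc (3 * n)

    V : ℕ → List Str
    V n = U (level n)

    depth : ℕ → ℕ
    depth n = codeSet (V n)

    maxLenV : ℕ → ℕ
    maxLenV n = maxLen (V n)

    maxLenV≤depth : ∀ n → maxLenV n ≤ depth n
    maxLenV≤depth n = maxLen≤codeSet (V n)

    covered : ℕ → Str → ℕ
    covered n τ = bit (any (λ σ → isPrefix σ τ) (V n))

    -- mass n σ = 2^(depth n) · mₙ(σ), since membership in Vₙ is decided by the first maxLenV n ≤ depth n bits.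
    mass : ℕ → Str → ℕ
    mass n σ = sumStr (λ ρ → covered n (σ ++ ρ)) (depth n)

    covered-++ : ∀ n τ ρ → maxLenV n ≤ length τ → covered n (τ ++ ρ) ≡ covered n τ
    covered-++ n τ ρ le = cong bit (any-cong (V n) (λ {σ} m → isPrefix-++ʳ σ τ ρ (≤-trans (∈⇒length≤maxLen (V n) m) le)))

    pp : ∀ p s → p * s + p * s ≡ (p + (p + 0)) * s
    pp = solve 2 (λ p s → p :* s :+ p :* s := (p :+ (p :+ con 0)) :* s) refl

    covered-refine : ∀ n j → sumStr (covered n) (maxLenV n + j) ≡ 2 ^ j * sumStr (covered n) (maxLenV n)
    covered-refine n zero rewrite +-identityʳ (maxLenV n) = sym (+-identityʳ _)
    covered-refine n (suc j) =
      begin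
        sumStr (covered n) (maxLenV n + suc j) ≡⟨ cong (sumStr (covered n)) (+-suc (maxLenV n) j) ⟩
        sumStr (covered n) (suc (maxLenV n + j)) ≡⟨ sumStr-snoc (covered n) (maxLenV n + j) ⟩
        sumStr (λ ρ → covered n (ρ ++ [ false ])) (maxLenV n + j) + sumStr (λ ρ → covered n (ρ ++ [ true ])) (maxLenV n + j)
          ≡⟨ cong₂ _+_ (sumStr-cong (maxLenV n + j) (λ ρ e → covered-++ n ρ [ false ] (subst (maxLenV n ≤_) (sym e) (m≤m+n _ _))))
                       (sumStr-cong (maxLenV n + j) (λ ρ e → covered-++ n ρ [ true ] (subst (maxLenV n ≤_) (sym e) (m≤m+n _ _)))) ⟩
        sumStr (covered n) (maxLenV n + j) + sumStr (covered n) (maxLenV n + j) ≡⟨ cong (λ x → x + x) (covered-refine n j) ⟩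
        2 ^ j * sumStr (covered n) (maxLenV n) + 2 ^ j * sumStr (covered n) (maxLenV n) ≡⟨ pp (2 ^ j) (sumStr (covered n) (maxLenV n)) ⟩
        2 ^ suc j * sumStr (covered n) (maxLenV n) ∎
      where open ≡-Reasoning

    covered-count-bound : ∀ n → sumStr (covered n) (maxLenV n) * 2 ^ level n ≤ 2 ^ maxLenV n
    covered-count-bound n = subst₂ _≤_
      (cong (_* 2 ^ level n) (length-filter-bit (λ τ → any (λ σ → isPrefix σ τ) (V n)) (allStrings (maxLenV n))))
      (+-identityʳ (2 ^ maxLenV n))
      (frac-≤⁻ (countCovered (V n) (maxLenV n)) (2 ^ maxLenV n) 1 (2 ^ level n)
               {{m^n≢0 2 (maxLenV n)}} {{m^n≢0 2 (level n)}} (U-small (level n)))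

    -- mₙ(τ) ≤ 2^|τ| μ(Vₙ) ≤ 2^-(2n+1) when |τ| = n.
    mass-bound : ∀ n τ → length τ ≡ n → mass n τ * 2 ^ suc (2 * n) ≤ 2 ^ depth n
    mass-bound n τ lenτ = *-cancelʳ-≤ _ _ (2 ^ n) {{m^n≢0 2 n}} chain
      where
      z = depth n
      M = maxLenV n
      j = n + z ∸ M
      Mle : M ≤ n + z
      Mle = ≤-trans (maxLenV≤depth n) (m≤n+m z n)
      eL : M + j ≡ n + z
      eL = m+[n∸m]≡n Mle
      tot : sumStr (covered n) (n + z) ≡ sumStr (λ σ → mass n σ) n
      tot = sumStr-split (covered n) n z
      single : mass n τ ≤ sumStr (covered n) (n + z)
      single = subst (mass n τ ≤_) (sym tot) (subst (λ L → mass n τ ≤ sumStr (λ σ → mass n σ) L) lenτ (≤sumStr (λ σ → mass n σ) τ))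
      ek : 2 ^ level n ≡ 2 ^ suc (2 * n) * 2 ^ n
      ek = trans (cong (2 ^_) (solve 1 (λ n → con 1 :+ con 3 :* n := (con 1 :+ con 2 :* n) :+ n) refl n)) (^-distribˡ-+-* 2 (suc (2 * n)) n)
      chain : mass n τ * 2 ^ suc (2 * n) * 2 ^ n ≤ 2 ^ z * 2 ^ n
      chain = begin
        mass n τ * 2 ^ suc (2 * n) * 2 ^ n ≡⟨ trans (*-assoc (mass n τ) _ _) (cong (mass n τ *_) (sym ek)) ⟩
        mass n τ * 2 ^ level n ≤⟨ *-monoˡ-≤ (2 ^ level n) single ⟩
        sumStr (covered n) (n + z) * 2 ^ level n ≡⟨ cong (λ L → sumStr (covered n) L * 2 ^ level n) (sym eL) ⟩
        sumStr (covered n) (M + j) * 2 ^ level n ≡⟨ cong (_* 2 ^ level n) (covered-refine n j) ⟩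
        2 ^ j * sumStr (covered n) M * 2 ^ level n ≡⟨ *-assoc (2 ^ j) _ _ ⟩
        2 ^ j * (sumStr (covered n) M * 2 ^ level n) ≤⟨ *-monoʳ-≤ (2 ^ j) (covered-count-bound n) ⟩
        2 ^ j * 2 ^ M ≡⟨ sym (^-distribˡ-+-* 2 j M) ⟩
        2 ^ (j + M) ≡⟨ cong (2 ^_) (trans (+-comm j M) eL) ⟩
        2 ^ (n + z) ≡⟨ trans (^-distribˡ-+-* 2 n z) (*-comm (2 ^ n) (2 ^ z)) ⟩
        2 ^ z * 2 ^ n ∎
        where open ≤-Reasoning

    mass-fair : ∀ n σ → mass n (σ ++ [ false ]) + mass n (σ ++ [ true ]) ≡ 2 * mass n σ
    mass-fair n σ = begin
      mass n (σ ++ [ false ]) + mass n (σ ++ [ true ])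
        ≡⟨ cong₂ _+_ (sumStr-cong z (λ ρ _ → cong (covered n) (++-assoc σ [ false ] ρ)))
                     (sumStr-cong z (λ ρ _ → cong (covered n) (++-assoc σ [ true ] ρ))) ⟩
      sumStr (λ ρ → covered n (σ ++ (false ∷ ρ))) z + sumStr (λ ρ → covered n (σ ++ (true ∷ ρ))) z
        ≡⟨ sym (sumStr-suc (λ ρ → covered n (σ ++ ρ)) z) ⟩
      sumStr (λ ρ → covered n (σ ++ ρ)) (suc z) ≡⟨ sumStr-snoc (λ ρ → covered n (σ ++ ρ)) z ⟩
      sumStr (λ ρ → covered n (σ ++ (ρ ++ [ false ]))) z + sumStr (λ ρ → covered n (σ ++ (ρ ++ [ true ]))) z
        ≡⟨ cong₂ _+_ (sumStr-cong z (λ ρ e → stab ρ [ false ] e)) (sumStr-cong z (λ ρ e → stab ρ [ true ] e)) ⟩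
      mass n σ + mass n σ ≡⟨ cong (mass n σ +_) (sym (+-identityʳ _)) ⟩
      2 * mass n σ ∎
      where
      open ≡-Reasoning
      z = depth n
      stab : ∀ ρ ρ' → length ρ ≡ z → covered n (σ ++ (ρ ++ ρ')) ≡ covered n (σ ++ ρ)
      stab ρ ρ' e = trans (cong (covered n) (sym (++-assoc σ ρ ρ')))
        (covered-++ n (σ ++ ρ) ρ' (≤-trans (maxLenV≤depth n) (subst (z ≤_) (sym (trans (length-++ σ) (cong (length σ +_) e))) (m≤n+m z (length σ)))))

    depthSum : ℕ → ℕ
    depthSum ℓ = sumTo depth (suc ℓ)

    scale : ℕ → ℕ
    scale ℓ = suc ℓ + depthSum ℓ

    baseCoef : ℕ → ℕ → ℕ
    baseCoef n ℓ = 2 ^ (scale ℓ ∸ suc n)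

    gainCoef : ℕ → ℕ → ℕ
    gainCoef n ℓ = 2 ^ (n + scale ℓ ∸ depth n)

    -- numer σ = 2^(scale |σ|) · d(σ): for n ≤ ℓ = |σ| the terms baseCoef n ℓ, gainCoef n ℓ · mass n σ and
    -- gainCoef n ℓ · mass n (take n σ) are 2^-(n+1), 2^n mₙ(σ) and 2^n mₙ(σ↾n) at that scale, and the
    -- leading 2^(scale ℓ ∸ suc ℓ) is Σ_{n > ℓ} 2^-(n+1).  The truncated subtraction is exact (negPart≤posPart).
    summand : ℕ → Str → ℕ → ℕ
    summand ℓ σ n = baseCoef n ℓ + gainCoef n ℓ * mass n σ

    posPart : ℕ → Str → ℕ
    posPart ℓ σ = 2 ^ (scale ℓ ∸ suc ℓ) + sumTo (summand ℓ σ) (suc ℓ)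

    negPart : ℕ → Str → ℕ
    negPart ℓ σ = sumTo (λ n → gainCoef n ℓ * mass n (take n σ)) (suc ℓ)

    numer′ : ℕ → Str → ℕ
    numer′ ℓ σ = posPart ℓ σ ∸ negPart ℓ σ

    numer : Str → ℕ
    numer σ = numer′ (length σ) σ

    depth≤depthSum : ∀ {n ℓ} → n ≤ ℓ → depth n ≤ depthSum ℓ
    depth≤depthSum {n} {ℓ} le = term≤sumTo depth (suc ℓ) n (s≤s le)

    suc≤scale : ∀ {n ℓ} → n ≤ ℓ → suc n ≤ scale ℓ
    suc≤scale {n} {ℓ} le = ≤-trans (s≤s le) (m≤m+n (suc ℓ) (depthSum ℓ))

    depth≤n+scale : ∀ {n ℓ} → n ≤ ℓ → depth n ≤ n + scale ℓ
    depth≤n+scale {n} {ℓ} le = ≤-trans (depth≤depthSum le) (≤-trans (m≤n+m (depthSum ℓ) (suc ℓ)) (m≤n+m (scale ℓ) n))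

    gain≤base : ∀ {n ℓ} τ → n ≤ ℓ → length τ ≡ n → gainCoef n ℓ * mass n τ ≤ baseCoef n ℓ
    gain≤base {n} {ℓ} τ le lenτ = *-cancelʳ-≤ _ _ (2 ^ p) {{m^n≢0 2 p}} (begin
        gainCoef n ℓ * mass n τ * 2 ^ p ≡⟨ *-assoc (gainCoef n ℓ) _ _ ⟩
        gainCoef n ℓ * (mass n τ * 2 ^ p) ≤⟨ *-monoʳ-≤ (gainCoef n ℓ) (mass-bound n τ lenτ) ⟩
        2 ^ (n + E ∸ z) * 2 ^ z ≡⟨ sym (^-distribˡ-+-* 2 (n + E ∸ z) z) ⟩
        2 ^ (n + E ∸ z + z) ≡⟨ cong (2 ^_) (trans (m∸n+n≡m (depth≤n+scale le)) e2) ⟩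
        2 ^ (E ∸ suc n + p) ≡⟨ ^-distribˡ-+-* 2 (E ∸ suc n) p ⟩
        baseCoef n ℓ * 2 ^ p ∎)
      where
      open ≤-Reasoning
      p = suc (2 * n)
      E = scale ℓ
      z = depth n
      x = E ∸ suc n
      eE : x + suc n ≡ E
      eE = m∸n+n≡m (suc≤scale le)
      e2 : n + E ≡ x + p
      e2 = trans (cong (n +_) (sym eE)) (solve 2 (λ n x → n :+ (x :+ (con 1 :+ n)) := x :+ (con 1 :+ con 2 :* n)) refl n x)

    baseSum : ℕ → ℕ
    baseSum ℓ = sumTo (λ n → baseCoef n ℓ) (suc ℓ)

    negPart≤baseSum : ∀ ℓ σ → length σ ≡ ℓ → negPart ℓ σ ≤ baseSum ℓ
    negPart≤baseSum ℓ σ e = sumTo-mono-≤ (suc ℓ) λ n n<1+ℓ →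
      gain≤base (take n σ) (≤-pred n<1+ℓ) (length-take-≤ n σ (subst (n ≤_) (sym e) (≤-pred n<1+ℓ)))

    baseSum≤posPart : ∀ ℓ σ → baseSum ℓ ≤ posPart ℓ σ
    baseSum≤posPart ℓ σ = ≤-trans (sumTo-mono-≤ (suc ℓ) (λ n _ → m≤m+n (baseCoef n ℓ) (gainCoef n ℓ * mass n σ)))
                                  (m≤n+m _ (2 ^ (scale ℓ ∸ suc ℓ)))

    negPart≤posPart : ∀ ℓ σ → length σ ≡ ℓ → negPart ℓ σ ≤ posPart ℓ σ
    negPart≤posPart ℓ σ e = ≤-trans (negPart≤baseSum ℓ σ e) (baseSum≤posPart ℓ σ)

    scaleStep : ℕ → ℕ
    scaleStep ℓ = suc (depth (suc ℓ))

    scale-suc : ∀ ℓ → scale (suc ℓ) ≡ scale ℓ + scaleStep ℓ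
    scale-suc ℓ = solve 3 (λ l Z z → con 2 :+ l :+ (Z :+ z) := (con 1 :+ l :+ Z) :+ (con 1 :+ z)) refl ℓ (depthSum ℓ) (depth (suc ℓ))

    baseCoef-suc : ∀ {n ℓ} → n ≤ ℓ → baseCoef n (suc ℓ) ≡ 2 ^ scaleStep ℓ * baseCoef n ℓ
    baseCoef-suc {n} {ℓ} le = begin
      2 ^ (scale (suc ℓ) ∸ suc n) ≡⟨ cong (λ e → 2 ^ (e ∸ suc n)) (scale-suc ℓ) ⟩
      2 ^ (scale ℓ + scaleStep ℓ ∸ suc n) ≡⟨ cong (2 ^_) (+-∸-comm (scaleStep ℓ) (suc≤scale le)) ⟩
      2 ^ (scale ℓ ∸ suc n + scaleStep ℓ) ≡⟨ ^-distribˡ-+-* 2 (scale ℓ ∸ suc n) (scaleStep ℓ) ⟩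
      baseCoef n ℓ * 2 ^ scaleStep ℓ ≡⟨ *-comm (baseCoef n ℓ) _ ⟩
      2 ^ scaleStep ℓ * baseCoef n ℓ ∎
      where open ≡-Reasoning

    gainCoef-suc : ∀ {n ℓ} → n ≤ ℓ → gainCoef n (suc ℓ) ≡ 2 ^ scaleStep ℓ * gainCoef n ℓ
    gainCoef-suc {n} {ℓ} le = begin
      2 ^ (n + scale (suc ℓ) ∸ depth n) ≡⟨ cong (λ e → 2 ^ (n + e ∸ depth n)) (scale-suc ℓ) ⟩
      2 ^ (n + (scale ℓ + scaleStep ℓ) ∸ depth n) ≡⟨ cong (λ e → 2 ^ (e ∸ depth n)) (sym (+-assoc n (scale ℓ) (scaleStep ℓ))) ⟩
      2 ^ (n + scale ℓ + scaleStep ℓ ∸ depth n) ≡⟨ cong (2 ^_) (+-∸-comm (scaleStep ℓ) (depth≤n+scale le)) ⟩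
      2 ^ (n + scale ℓ ∸ depth n + scaleStep ℓ) ≡⟨ ^-distribˡ-+-* 2 (n + scale ℓ ∸ depth n) (scaleStep ℓ) ⟩
      gainCoef n ℓ * 2 ^ scaleStep ℓ ≡⟨ *-comm (gainCoef n ℓ) _ ⟩
      2 ^ scaleStep ℓ * gainCoef n ℓ ∎
      where open ≡-Reasoning

    scale∸suc : ∀ ℓ → scale ℓ ∸ suc ℓ ≡ depthSum ℓ
    scale∸suc ℓ = m+n∸m≡n (suc ℓ) (depthSum ℓ)

    lead-suc : ∀ ℓ → 4 * 2 ^ (scale (suc ℓ) ∸ suc (suc ℓ)) ≡ 2 ^ suc (scaleStep ℓ) * 2 ^ (scale ℓ ∸ suc ℓ)
    lead-suc ℓ = begin
      4 * 2 ^ (scale (suc ℓ) ∸ suc (suc ℓ)) ≡⟨ cong (λ e → 4 * 2 ^ e) (scale∸suc (suc ℓ)) ⟩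
      4 * 2 ^ (depthSum ℓ + depth (suc ℓ)) ≡⟨ cong (4 *_) (^-distribˡ-+-* 2 (depthSum ℓ) (depth (suc ℓ))) ⟩
      4 * (2 ^ depthSum ℓ * 2 ^ depth (suc ℓ)) ≡⟨ l4 (2 ^ depthSum ℓ) (2 ^ depth (suc ℓ)) ⟩
      2 ^ suc (scaleStep ℓ) * 2 ^ depthSum ℓ ≡⟨ cong (λ e → 2 ^ suc (scaleStep ℓ) * 2 ^ e) (sym (scale∸suc ℓ)) ⟩
      2 ^ suc (scaleStep ℓ) * 2 ^ (scale ℓ ∸ suc ℓ) ∎
      where
      open ≡-Reasoning
      l4 : ∀ a b → 4 * (a * b) ≡ (2 * (2 * b)) * a
      l4 = solve 2 (λ a b → con 4 :* (a :* b) := (con 2 :* (con 2 :* b)) :* a) refl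

    newTerms : ℕ → Str → ℕ
    newTerms ℓ σ = gainCoef (suc ℓ) (suc ℓ) * (mass (suc ℓ) (σ ++ [ false ]) + mass (suc ℓ) (σ ++ [ true ]))

    summand-fair : ∀ {ℓ n} σ → n ≤ ℓ →
      summand (suc ℓ) (σ ++ [ false ]) n + summand (suc ℓ) (σ ++ [ true ]) n ≡ 2 ^ suc (scaleStep ℓ) * summand ℓ σ n
    summand-fair {ℓ} {n} σ le = begin
      (baseCoef n (suc ℓ) + gainCoef n (suc ℓ) * c₀) + (baseCoef n (suc ℓ) + gainCoef n (suc ℓ) * c₁)
        ≡⟨ cong₂ (λ x y → (x + y * c₀) + (x + y * c₁)) (baseCoef-suc le) (gainCoef-suc le) ⟩
      (D * a + D * b * c₀) + (D * a + D * b * c₁)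
        ≡⟨ solve 5 (λ D a b c₀ c₁ → (D :* a :+ D :* b :* c₀) :+ (D :* a :+ D :* b :* c₁)
                                   := (con 2 :* D) :* a :+ D :* b :* (c₀ :+ c₁)) refl D a b c₀ c₁ ⟩
      (2 * D) * a + D * b * (c₀ + c₁)
        ≡⟨ cong (λ x → (2 * D) * a + D * b * x) (mass-fair n σ) ⟩
      (2 * D) * a + D * b * (2 * mass n σ)
        ≡⟨ solve 4 (λ D a b c → (con 2 :* D) :* a :+ D :* b :* (con 2 :* c) := (con 2 :* D) :* (a :+ b :* c)) refl D a b (mass n σ) ⟩
      (2 * D) * summand ℓ σ n ∎
      where
      open ≡-Reasoning
      D = 2 ^ scaleStep ℓ
      a = baseCoef n ℓ
      b = gainCoef n ℓ
      c₀ = mass n (σ ++ [ false ])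
      c₁ = mass n (σ ++ [ true ])

    posPart-fair : ∀ ℓ σ → posPart (suc ℓ) (σ ++ [ false ]) + posPart (suc ℓ) (σ ++ [ true ])
                         ≡ 2 ^ suc (scaleStep ℓ) * posPart ℓ σ + newTerms ℓ σ
    posPart-fair ℓ σ = begin
      (K + (S₀ + summand (suc ℓ) σ₀ (suc ℓ))) + (K + (S₁ + summand (suc ℓ) σ₁ (suc ℓ)))
        ≡⟨ solve 7 (λ K S₀ S₁ A B C₀ C₁ → (K :+ (S₀ :+ (A :+ B :* C₀))) :+ (K :+ (S₁ :+ (A :+ B :* C₁)))
                                        := (con 2 :* K :+ con 2 :* A) :+ (S₀ :+ S₁) :+ B :* (C₀ :+ C₁))
                   refl K S₀ S₁ K (gainCoef (suc ℓ) (suc ℓ)) (mass (suc ℓ) σ₀) (mass (suc ℓ) σ₁) ⟩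
      (2 * K + 2 * K) + (S₀ + S₁) + newTerms ℓ σ
        ≡⟨ cong₂ (λ x y → x + y + newTerms ℓ σ) (trans (solve 1 (λ K → con 2 :* K :+ con 2 :* K := con 4 :* K) refl K) (lead-suc ℓ)) sums ⟩
      D₂ * L + D₂ * Sσ + newTerms ℓ σ
        ≡⟨ cong (_+ newTerms ℓ σ) (sym (*-distribˡ-+ D₂ L Sσ)) ⟩
      D₂ * (L + Sσ) + newTerms ℓ σ ∎
      where
      open ≡-Reasoning
      σ₀ = σ ++ [ false ]
      σ₁ = σ ++ [ true ]
      K = 2 ^ (scale (suc ℓ) ∸ suc (suc ℓ))
      D₂ = 2 ^ suc (scaleStep ℓ)
      L = 2 ^ (scale ℓ ∸ suc ℓ)
      S₀ = sumTo (summand (suc ℓ) σ₀) (suc ℓ)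
      S₁ = sumTo (summand (suc ℓ) σ₁) (suc ℓ)
      Sσ = sumTo (summand ℓ σ) (suc ℓ)
      sums : S₀ + S₁ ≡ D₂ * Sσ
      sums = trans (sym (sumTo-+ (summand (suc ℓ) σ₀) (summand (suc ℓ) σ₁) (suc ℓ)))
                   (trans (sumTo-cong (suc ℓ) (λ n lt → summand-fair σ (≤-pred lt))) (sumTo-*ˡ D₂ (summand ℓ σ) (suc ℓ)))

    negPart-fair : ∀ ℓ σ → length σ ≡ ℓ → negPart (suc ℓ) (σ ++ [ false ]) + negPart (suc ℓ) (σ ++ [ true ])
                                       ≡ 2 ^ suc (scaleStep ℓ) * negPart ℓ σ + newTerms ℓ σ
    negPart-fair ℓ σ e = begin
      (R0 + B * mass (suc ℓ) (take (suc ℓ) σ0)) + (R1 + B * mass (suc ℓ) (take (suc ℓ) σ1))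
        ≡⟨ cong₂ (λ x y → (R0 + B * mass (suc ℓ) x) + (R1 + B * mass (suc ℓ) y)) (tk false) (tk true) ⟩
      (R0 + B * C0) + (R1 + B * C1) ≡⟨ cong₂ (λ x y → (x + B * C0) + (y + B * C1)) (rs false) (rs true) ⟩
      (D * Q + B * C0) + (D * Q + B * C1)
        ≡⟨ solve 5 (λ D Q B C0 C1 → (D :* Q :+ B :* C0) :+ (D :* Q :+ B :* C1) := (con 2 :* D) :* Q :+ B :* (C0 :+ C1)) refl D Q B C0 C1 ⟩
      2 ^ suc (scaleStep ℓ) * Q + newTerms ℓ σ ∎
      where
      open ≡-Reasoning
      σ0 = σ ++ [ false ]
      σ1 = σ ++ [ true ]
      B = gainCoef (suc ℓ) (suc ℓ)
      C0 = mass (suc ℓ) σ0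
      C1 = mass (suc ℓ) σ1
      D = 2 ^ scaleStep ℓ
      Q = negPart ℓ σ
      R : Bool → ℕ
      R b = sumTo (λ n → gainCoef n (suc ℓ) * mass n (take n (σ ++ [ b ]))) (suc ℓ)
      R0 = R false
      R1 = R true
      tk : ∀ b → take (suc ℓ) (σ ++ [ b ]) ≡ σ ++ [ b ]
      tk b = take-all (suc ℓ) (σ ++ [ b ]) (≤-reflexive (trans (length-snoc σ b) (cong suc e)))
      rs : ∀ b → R b ≡ D * Q
      rs b = trans (sumTo-cong (suc ℓ) λ n lt →
                     cong₂ _*_ (gainCoef-suc (≤-pred lt)) (cong (mass n) (take-++ʳ n σ [ b ] (subst (n ≤_) (sym e) (≤-pred lt)))))
             (trans (sumTo-cong (suc ℓ) (λ n _ → *-assoc D (gainCoef n ℓ) _)) (sumTo-*ˡ D (λ n → gainCoef n ℓ * mass n (take n σ)) (suc ℓ)))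

    numer-fair : ∀ σ → numer (σ ++ [ false ]) + numer (σ ++ [ true ]) ≡ 2 ^ suc (scaleStep (length σ)) * numer σ
    numer-fair σ = begin
      numer σ0 + numer σ1 ≡⟨ cong₂ _+_ (cong (λ k → numer′ k σ0) (length-snoc σ false)) (cong (λ k → numer′ k σ1) (length-snoc σ true)) ⟩
      (P0 ∸ Q0) + (P1 ∸ Q1)
        ≡⟨ [m∸n]+[o∸p]≡[m+o]∸[n+p] P0 Q0 P1 Q1 (negPart≤posPart (suc ℓ) σ0 (length-snoc σ false))
                                              (negPart≤posPart (suc ℓ) σ1 (length-snoc σ true)) ⟩
      (P0 + P1) ∸ (Q0 + Q1) ≡⟨ cong₂ _∸_ (posPart-fair ℓ σ) (negPart-fair ℓ σ refl) ⟩
      (D₂ * posPart ℓ σ + newTerms ℓ σ) ∸ (D₂ * negPart ℓ σ + newTerms ℓ σ)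
        ≡⟨ [m+o]∸[n+o]≡m∸n (D₂ * posPart ℓ σ) (D₂ * negPart ℓ σ) (newTerms ℓ σ) ⟩
      D₂ * posPart ℓ σ ∸ D₂ * negPart ℓ σ ≡⟨ sym (*-distribˡ-∸ D₂ (posPart ℓ σ) (negPart ℓ σ)) ⟩
      D₂ * (posPart ℓ σ ∸ negPart ℓ σ) ∎
      where
      open ≡-Reasoning
      ℓ = length σ
      σ0 = σ ++ [ false ]
      σ1 = σ ++ [ true ]
      P0 = posPart (suc ℓ) σ0
      P1 = posPart (suc ℓ) σ1
      Q0 = negPart (suc ℓ) σ0
      Q1 = negPart (suc ℓ) σ1
      D₂ = 2 ^ suc (scaleStep ℓ)

    numer-root : numer [] ≡ 2 ^ scale 0
    numer-root = begin
      (L + (0 + (baseCoef 0 0 + t))) ∸ (0 + t) ≡⟨ cong (_∸ t) (solve 3 (λ L a t → L :+ (con 0 :+ (a :+ t)) := (L :+ a) :+ t) refl L (baseCoef 0 0) t) ⟩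
      (L + baseCoef 0 0 + t) ∸ (0 + t) ≡⟨ [m+o]∸[n+o]≡m∸n (L + baseCoef 0 0) 0 t ⟩
      L + baseCoef 0 0 ≡⟨ cong (λ e → 2 ^ e + 2 ^ e) (scale∸suc 0) ⟩
      2 ^ depthSum 0 + 2 ^ depthSum 0 ≡⟨ cong (2 ^ depthSum 0 +_) (sym (+-identityʳ _)) ⟩
      2 ^ scale 0 ∎
      where
      open ≡-Reasoning
      L = 2 ^ (scale 0 ∸ 1)
      t = gainCoef 0 0 * mass 0 []

    mass-full : ∀ n σ {τ} → τ ∈ V n → isPrefix τ σ ≡ true → maxLenV n ≤ length σ → mass n σ ≡ 2 ^ depth n
    mass-full n σ {τ} τ∈V τ⊑σ le =
      trans (sumStr-cong (depth n) (λ ρ _ → covered-extension ρ)) (trans (sumStr-const 1 (depth n)) (*-identityʳ _))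
      where
      covered-extension : ∀ ρ → covered n (σ ++ ρ) ≡ 1
      covered-extension ρ = cong bit (any-intro (λ s → isPrefix s (σ ++ ρ)) τ∈V
        (trans (isPrefix-++ʳ τ σ ρ (≤-trans (∈⇒length≤maxLen (V n) τ∈V) le)) τ⊑σ))

    numer-success : ∀ n σ → n ≤ length σ → mass n σ ≡ 2 ^ depth n → 2 ^ n * 2 ^ scale (length σ) ≤ numer σ
    numer-success n σ le full = begin
      2 ^ n * 2 ^ E                       ≡⟨ sym (^-distribˡ-+-* 2 n E) ⟩
      2 ^ (n + E)                         ≡⟨ sym (m+n∸n≡m (2 ^ (n + E)) (baseSum ℓ)) ⟩
      2 ^ (n + E) + baseSum ℓ ∸ baseSum ℓ ≤⟨ ∸-mono gain+base≤posPart (negPart≤baseSum ℓ σ refl) ⟩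
      posPart ℓ σ ∸ negPart ℓ σ           ∎
      where
      open ≤-Reasoning
      ℓ = length σ
      E = scale ℓ
      gain : ℕ → ℕ
      gain j = gainCoef j ℓ * mass j σ
      gain≡ : gain n ≡ 2 ^ (n + E)
      gain≡ = trans (cong (gainCoef n ℓ *_) full)
        (trans (sym (^-distribˡ-+-* 2 (n + E ∸ depth n) (depth n))) (cong (2 ^_) (m∸n+n≡m (depth≤n+scale le))))
      gain+base≤posPart : 2 ^ (n + E) + baseSum ℓ ≤ posPart ℓ σ
      gain+base≤posPart = begin
        2 ^ (n + E) + baseSum ℓ
          ≤⟨ +-monoˡ-≤ (baseSum ℓ) (subst (_≤ sumTo gain (suc ℓ)) gain≡ (term≤sumTo gain (suc ℓ) n (s≤s le))) ⟩
        sumTo gain (suc ℓ) + baseSum ℓ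
          ≡⟨ +-comm (sumTo gain (suc ℓ)) (baseSum ℓ) ⟩
        baseSum ℓ + sumTo gain (suc ℓ)
          ≡⟨ sym (sumTo-+ (λ j → baseCoef j ℓ) gain (suc ℓ)) ⟩
        sumTo (summand ℓ σ) (suc ℓ)
          ≤⟨ m≤n+m _ (2 ^ (scale ℓ ∸ suc ℓ)) ⟩
        posPart ℓ σ ∎

module TestToMartingale where

  open Fraction
  open PrimRec
  open Pairing
  open StringCode
  open StringSum
  open Strings
  open PrefixCover
  open Arithmetic
  open CoverMartingale
  open import Data.Nat as ℕ using (ℕ; suc; _+_; _*_; _∸_; _^_; _≤_; _<_; z≤n)
  open import Data.Nat.Properties
  open import Data.Bool using (true; false)
  open import Data.List using (List; []; _∷_; _++_; [_]; length; take)
  open import Data.List.Membership.Propositional using (_∈_)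
  open import Data.Vec using ([]; _∷_)
  open import Data.Product using (_,_; proj₁; proj₂)
  open import Data.Integer using (+_)
  open import Data.Rational as ℚ using (ℚ)
  import Data.Rational.Properties as ℚP
  open import Relation.Binary.PropositionalEquality hiding ([_])
  open import Data.Nat.Solver using (module +-*-Solver)
  open +-*-Solver

  module Construction (U : ℕ → List Str) (U-pr : IsPrimRec (λ k → codeSet (U k))) (U-small : ∀ k → μ (U k) ℚ.≤ 2^- k) where
    open Numerator U U-small

    -- The extensions ρ of length depth n have codes 2^(depth n) ∸ 1 + r (r < 2^(depth n)),
    -- and codeStr (σ ++ ρ) = codeStr σ + 2^|σ| · codeStr ρ.
    massCode′ : ℕ → ℕ → ℕ → ℕ
    massCode′ ℓ n c = sumTo (λ r → covers (depth n) (c + 2 ^ ℓ * (2 ^ depth n ∸ 1 + r))) (2 ^ depth n)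

    massCode : ℕ → ℕ → ℕ
    massCode n c = massCode′ (codeLength c) n c

    posPartCode : ℕ → ℕ → ℕ
    posPartCode ℓ c = 2 ^ (scale ℓ ∸ suc ℓ) + sumTo (λ n → baseCoef n ℓ + gainCoef n ℓ * massCode n c) (suc ℓ)

    negPartCode : ℕ → ℕ → ℕ
    negPartCode ℓ c = sumTo (λ n → gainCoef n ℓ * massCode n (takeCode c n)) (suc ℓ)

    numerCode : ℕ → ℕ
    numerCode c = posPartCode (codeLength c) c ∸ negPartCode (codeLength c) c

    denomCode : ℕ → ℕ
    denomCode c = 2 ^ scale (codeLength c) ∸ 1

    massCode-codeStr : ∀ n σ → massCode n (codeStr σ) ≡ mass n σ
    massCode-codeStr n σ = trans (cong (λ ℓ → massCode′ ℓ n (codeStr σ)) (codeLength-codeStr σ))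
      (sym (trans (sumStr-cong (depth n) (λ ρ _ → covered≡ ρ)) (sumStr-codeStr F (depth n))))
      where
      F : ℕ → ℕ
      F x = covers (depth n) (codeStr σ + 2 ^ length σ * x)
      covered≡ : ∀ ρ → covered n (σ ++ ρ) ≡ F (codeStr ρ)
      covered≡ ρ = trans (sym (covers-codeSet (V n) (σ ++ ρ))) (cong (covers (depth n)) (codeStr-++ σ ρ))

    numerCode-codeStr : ∀ σ → numerCode (codeStr σ) ≡ numer σ
    numerCode-codeStr σ = trans (cong (λ ℓ → posPartCode ℓ (codeStr σ) ∸ negPartCode ℓ (codeStr σ)) (codeLength-codeStr σ))
      (cong₂ _∸_ (cong (λ x → 2 ^ (scale ℓ ∸ suc ℓ) + x) (sumTo-cong (suc ℓ) λ n _ →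
                    cong (λ x → baseCoef n ℓ + gainCoef n ℓ * x) (massCode-codeStr n σ)))
                 (sumTo-cong (suc ℓ) λ n lt →
                    cong (gainCoef n ℓ *_) (trans (cong (massCode n) (takeCode-codeStr n σ (≤-pred lt))) (massCode-codeStr n (take n σ)))))
      where ℓ = length σ

    d : Str → ℚ
    d σ = ℚ._/_ (+ numerCode (codeStr σ)) (suc (denomCode (codeStr σ)))

    denomCode-codeStr : ∀ σ → suc (denomCode (codeStr σ)) ≡ 2 ^ scale (length σ)
    denomCode-codeStr σ = trans (cong (λ ℓ → suc (2 ^ scale ℓ ∸ 1)) (codeLength-codeStr σ))
      (trans (+-comm 1 (2 ^ scale (length σ) ∸ 1)) (m∸n+n≡m (m^n>0 2 (scale (length σ)))))

    d≡frac : ∀ σ → d σ ≡ frac (numer σ) (2 ^ scale (length σ)) {{m^n≢0 2 (scale (length σ))}}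
    d≡frac σ = ℚP./-cong {{_}} {{m^n≢0 2 (scale (length σ))}} (cong +_ (numerCode-codeStr σ)) (denomCode-codeStr σ)

    d-nonneg : ∀ σ → ℚ.0ℚ ℚ.≤ d σ
    d-nonneg σ = subst (ℚ.0ℚ ℚ.≤_) (sym (d≡frac σ))
      (frac-≤ 0 1 (numer σ) (2 ^ scale (length σ)) {{_}} {{m^n≢0 2 (scale (length σ))}} z≤n)

    d-root : d [] ≡ ℚ.1ℚ
    d-root = trans (d≡frac []) (trans (cong (λ x → frac x (2 ^ scale 0) {{m^n≢0 2 (scale 0)}}) numer-root)
      (frac-≡ (2 ^ scale 0) (2 ^ scale 0) 1 1 {{m^n≢0 2 (scale 0)}} (trans (*-identityʳ _) (sym (*-identityˡ _)))))

    numer-fair-cross : ∀ σ → let p = 2 ^ scale (length σ) ; p′ = 2 ^ scale (suc (length σ)) in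
      numer σ * (2 * (p′ * p′)) ≡ (1 * (numer (σ ++ [ false ]) * p′ + numer (σ ++ [ true ]) * p′)) * p
    numer-fair-cross σ = begin
      N * (2 * (p′ * p′))       ≡⟨ cong (λ x → N * (2 * (x * p′))) p′≡ ⟩
      N * (2 * (p * D * p′))    ≡⟨ solve 4 (λ N p D q → N :* (con 2 :* (p :* D :* q)) := (con 2 :* D :* N) :* q :* p) refl N p D p′ ⟩
      (2 * D * N) * p′ * p      ≡⟨ cong (λ x → x * p′ * p) (sym (numer-fair σ)) ⟩
      (N₀ + N₁) * p′ * p        ≡⟨ solve 4 (λ a b q p → (a :+ b) :* q :* p := (con 1 :* (a :* q :+ b :* q)) :* p) refl N₀ N₁ p′ p ⟩
      (1 * (N₀ * p′ + N₁ * p′)) * p ∎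
      where
      open ≡-Reasoning
      ℓ = length σ
      N = numer σ
      N₀ = numer (σ ++ [ false ])
      N₁ = numer (σ ++ [ true ])
      p = 2 ^ scale ℓ
      p′ = 2 ^ scale (suc ℓ)
      D = 2 ^ scaleStep ℓ
      p′≡ : p′ ≡ p * D
      p′≡ = trans (cong (2 ^_) (scale-suc ℓ)) (^-distribˡ-+-* 2 (scale ℓ) (scaleStep ℓ))

    d-fair : ∀ σ → d σ ≡ ℚ.½ ℚ.* (d (σ ++ [ false ]) ℚ.+ d (σ ++ [ true ]))
    d-fair σ = begin
      d σ
        ≡⟨ d≡frac σ ⟩
      frac N p {{p≢0}}
        ≡⟨ frac-≡ N p (1 * (N₀ * p′ + N₁ * p′)) (2 * (p′ * p′)) {{p≢0}} {{m*n≢0 2 (p′ * p′) {{_}} {{p′²≢0}}}} (numer-fair-cross σ) ⟩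
      frac (1 * (N₀ * p′ + N₁ * p′)) (2 * (p′ * p′)) {{m*n≢0 2 (p′ * p′) {{_}} {{p′²≢0}}}}
        ≡⟨ sym (frac-* 1 2 (N₀ * p′ + N₁ * p′) (p′ * p′) {{_}} {{p′²≢0}}) ⟩
      frac 1 2 ℚ.* frac (N₀ * p′ + N₁ * p′) (p′ * p′) {{p′²≢0}}
        ≡⟨ cong (frac 1 2 ℚ.*_) (sym (frac-+ N₀ p′ N₁ p′ {{p′≢0}} {{p′≢0}})) ⟩
      frac 1 2 ℚ.* (frac N₀ p′ {{p′≢0}} ℚ.+ frac N₁ p′ {{p′≢0}})
        ≡⟨ cong₂ (λ x y → ℚ.½ ℚ.* (x ℚ.+ y)) (sym (d-child false)) (sym (d-child true)) ⟩
      ℚ.½ ℚ.* (d (σ ++ [ false ]) ℚ.+ d (σ ++ [ true ])) ∎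
      where
      open ≡-Reasoning
      ℓ = length σ
      N = numer σ
      N₀ = numer (σ ++ [ false ])
      N₁ = numer (σ ++ [ true ])
      p = 2 ^ scale ℓ
      p′ = 2 ^ scale (suc ℓ)
      p≢0 = m^n≢0 2 (scale ℓ)
      p′≢0 = m^n≢0 2 (scale (suc ℓ))
      p′²≢0 = m*n≢0 p′ p′ {{p′≢0}} {{p′≢0}}
      d-child : ∀ b → d (σ ++ [ b ]) ≡ frac (numer (σ ++ [ b ])) p′ {{p′≢0}}
      d-child b = trans (d≡frac (σ ++ [ b ]))
        (ℚP./-cong {+ numer (σ ++ [ b ])} {_} {+ numer (σ ++ [ b ])} {{m^n≢0 2 (scale (length (σ ++ [ b ])))}} {{p′≢0}}
                   refl (cong (λ k → 2 ^ scale k) (length-snoc σ b)))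

    isMartingale : IsMartingale d
    isMartingale = record { nonneg = d-nonneg ; root = d-root ; fair = d-fair }

    codeVF : PRFun 1
    codeVF = mkF (uncurry₁ (λ k → codeSet (U k))) (proj₁ U-pr , λ { (k ∷ []) → proj₂ U-pr k })

    depthF : PRFun 1
    depthF = fromTerm (uncurry₁ depth) (codeVF $1 (succF $1 (mulF $2 lit 3 , var₀))) λ { (n ∷ []) → refl }

    depthSumF : PRFun 1
    depthSumF = fromTerm (uncurry₁ depthSum) (sumF depthF $1 (succF $1 var₀)) λ { (ℓ ∷ []) → refl }

    scaleF : PRFun 1
    scaleF = fromTerm (uncurry₁ scale) (addF $2 (succF $1 var₀) , (depthSumF $1 var₀)) λ { (ℓ ∷ []) → refl }

    baseCoefF : PRFun 2
    baseCoefF = fromTerm (uncurry₂ baseCoef)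
      (pow2F $1 (monusF $2 (scaleF $1 var₁) , (succF $1 var₀)))
      λ { (n ∷ ℓ ∷ []) → refl }

    gainCoefF : PRFun 2
    gainCoefF = fromTerm (uncurry₂ gainCoef)
      (pow2F $1 (monusF $2 (addF $2 var₀ , (scaleF $1 var₁)) , (depthF $1 var₀)))
      λ { (n ∷ ℓ ∷ []) → refl }

    massCodeSummandF : PRFun 4
    massCodeSummandF = fromTerm (λ { (r ∷ ℓ ∷ n ∷ c ∷ []) → covers (depth n) (c + 2 ^ ℓ * (2 ^ depth n ∸ 1 + r)) })
      (coversF $2 (depthF $1 var₂) ,
                  (addF $2 var₃ , (mulF $2 (pow2F $1 var₁) , (addF $2 (monusF $2 (pow2F $1 (depthF $1 var₂)) , lit 1) , var₀))))
      λ { (r ∷ ℓ ∷ n ∷ c ∷ []) → refl }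

    massCodeF : PRFun 2
    massCodeF = fromTerm (uncurry₂ massCode)
      (op (sumF massCodeSummandF) (pow2F $1 (depthF $1 var₀) ∷ codeLengthF $1 var₁ ∷ var₀ ∷ var₁ ∷ []))
      λ { (n ∷ c ∷ []) → refl }

    posPartSummandF : PRFun 3
    posPartSummandF = fromTerm (uncurry₃ λ n ℓ c → baseCoef n ℓ + gainCoef n ℓ * massCode n c)
      (addF $2 (baseCoefF $2 var₀ , var₁) , (mulF $2 (gainCoefF $2 var₀ , var₁) , (massCodeF $2 var₀ , var₂)))
      λ { (n ∷ ℓ ∷ c ∷ []) → refl }

    negPartSummandF : PRFun 3
    negPartSummandF = fromTerm (uncurry₃ λ n ℓ c → gainCoef n ℓ * massCode n (takeCode c n))
      (mulF $2 (gainCoefF $2 var₀ , var₁) , (massCodeF $2 var₀ , (takeCodeF $2 var₂ , var₀)))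
      λ { (n ∷ ℓ ∷ c ∷ []) → refl }

    posPartCodeF : PRFun 2
    posPartCodeF = fromTerm (uncurry₂ posPartCode)
      (addF $2 (pow2F $1 (monusF $2 (scaleF $1 var₀) , (succF $1 var₀))) ,
               app3 (sumF posPartSummandF) (succF $1 var₀) var₀ var₁)
      λ { (ℓ ∷ c ∷ []) → refl }

    negPartCodeF : PRFun 2
    negPartCodeF = fromTerm (uncurry₂ negPartCode)
      (app3 (sumF negPartSummandF) (succF $1 var₀) var₀ var₁)
      λ { (ℓ ∷ c ∷ []) → refl }

    numerCodeF : PRFun 1
    numerCodeF = fromTerm (uncurry₁ numerCode)
      (monusF $2 (posPartCodeF $2 (codeLengthF $1 var₀) , var₀) , (negPartCodeF $2 (codeLengthF $1 var₀) , var₀))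
      λ { (c ∷ []) → refl }

    denomCodeF : PRFun 1
    denomCodeF = fromTerm (uncurry₁ denomCode)
      (monusF $2 (pow2F $1 (scaleF $1 (codeLengthF $1 var₀))) , lit 1)
      λ { (c ∷ []) → refl }

    numer,denomF : PRFun 1
    numer,denomF = fromTerm (uncurry₁ λ c → pair (numerCode c) (denomCode c))
      (pairF $2 (numerCodeF $1 var₀) , (denomCodeF $1 var₀))
      λ { (c ∷ []) → refl }

    successTime : ℕ → ℕ
    successTime n = n + depth n

    successTimeF : PRFun 1
    successTimeF = fromTerm (uncurry₁ successTime) (addF $2 var₀ , (depthF $1 var₀)) λ { (n ∷ []) → refl }

    isPrimRecMartingale : IsPrimRecMartingale d
    isPrimRecMartingale = numerCode , denomCode , toIsPrimRec numer,denomF , λ σ → refl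

    succeeds : ∀ X → (∀ k → X ∈[ U k ]) → ∀ n → (+ (2 ^ n)) ℚ./ 1 ℚ.≤ d (X ↾ successTime n)
    succeeds X X∈U n = subst ((+ (2 ^ n)) ℚ./ 1 ℚ.≤_) (sym (d≡frac σ))
      (frac-≤ (2 ^ n) 1 (numer σ) (2 ^ scale (length σ)) {{_}} {{m^n≢0 2 (scale (length σ))}}
        (subst (2 ^ n * 2 ^ scale (length σ) ≤_) (sym (*-identityʳ (numer σ))) (numer-success n σ n≤ full)))
      where
      σ = X ↾ successTime n
      |σ| : length σ ≡ successTime n
      |σ| = length-↾ X (successTime n)
      n≤ : n ≤ length σ
      n≤ = subst (n ≤_) (sym |σ|) (m≤m+n n (depth n))
      full : mass n σ ≡ 2 ^ depth n
      full with X∈U (level n)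
      ... | τ , τ∈V , τ⊏X = mass-full n σ τ∈V
        (subst (λ s → isPrefix s σ ≡ true) τ⊏X (↾-isPrefix X (length τ) (successTime n) (≤-trans |τ|≤ (m≤n+m (depth n) n))))
        (subst (_ ≤_) (sym |σ|) (≤-trans (maxLenV≤depth n) (m≤n+m (depth n) n)))
        where
        |τ|≤ : length τ ≤ depth n
        |τ|≤ = ≤-trans (∈⇒length≤maxLen (V n) τ∈V) (maxLenV≤depth n)

  martingaleRandom⇒mlRandom : ∀ X → MartingaleBPRandom X → MLBPRandom X
  martingaleRandom⇒mlRandom X mr T X∈U = mr (d , isMartingale , isPrimRecMartingale , successTime , toIsPrimRec successTimeF , succeeds X X∈U)
    where open Construction (PRTest.G T) (PRTest.primrec T) (PRTest.small T)

theorem2p5 : (X : Real) → MLBPRandom X ⇔ MartingaleBPRandom X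
theorem2p5 X = mk⇔ (MartingaleToTest.mlRandom⇒martingaleRandom X) (TestToMartingale.martingaleRandom⇒mlRandom X)
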